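{- Let $G=(A,B,E)$ be a bipartite graph with a proper edge coloring $\chi:E\to\{1,\dots,d\}$, $d\ge 2$, and let $G'=(A,B,E')$ be the (random) output of either lexicographic or reversed thinning, with $t=\lceil(\log d)/2\rceil+1$. Then $$\mathbb{E}[|E'|]\ge \frac{t-1}{240d}|E|\ge\frac{\log d}{480d}|E|.$$
   Context: A bipartite graph is a triple $G=(A,B,E)$ with disjoint $A,B$ and $E\subseteq A\times B$, edges written $(x,y)$ with $x\in A$, $y\in B$; a proper edge coloring gives adjacent edges distinct colors. $\log$ is the binary logarithm. For distinct $a,b\in\{0,1\}^t$, $P(a,b)$ is the first position where they differ; $\{0,1\}^t$ is ordered lexicographically. Thinning procedures: $H$ is the set of triples $(a,i,z)$ with $a\in\{0,1\}^t$, $i\in\{2,\dots,t\}$, $z\in\{1,\dots,2^i\}$, $a$ having $0$ in position $i$. In lexicographic thinning $H$ is ordered by $(a,i,z)<(b,j,s)$ iff $a<b$, or $a=b$ and $i<j$, or $(a,i)=(b,j)$ and $z<s$; in reversed thinning by $a<b$, or $a=b$ and $i>j$, or $(a,i)=(b,j)$ and $z<s$. A random $F:\{1,\dots,d\}\to H$ is chosen with $F(1)$ uniform among elements whose $a$ has first bit $0$ and $F(k)$ the successor of $F(k-1)$ in $H$. An edge $e$ with $F(\chi(e))=(a,i,z)$ has class $a$ and type $i$. Independent uniform $a_x\in\{0,1\}^t$ are chosen for all vertices $x$. An edge $(x,y)$ of class $a$ and type $i$ is eligible if $a=a_y<a_x$ and $P(a,a_x)=i$. $E'$ consists of the eligible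 edges not adjacent to another eligible edge of the same type. -}

module Defs where

open import Data.Bool using (Bool; true; false; _∧_; _∨_; not; if_then_else_)
open import Data.Nat using (ℕ; zero; suc; _+_; _*_; _∸_; _^_; _≤_; _≡ᵇ_; ⌈_/2⌉)
open import Data.Nat.Logarithm using (⌈log₂_⌉)
open import Data.List using (List; []; _∷_; [_]; map; _++_; concatMap; upTo; filter; length; reverse)
open import Data.Nat.ListAction using (sum)
open import Data.Bool.ListAction using (any)
open import Data.Vec using (Vec; lookup) renaming ([] to []ᵥ; _∷_ to _∷ᵥ_)
open import Data.Fin using (Fin; toℕ)
open import Data.Maybe using (Maybe; just; nothing)
open import Data.Product using (_×_; _,_; proj₁; proj₂)
open import Data.Sum using (_⊎_)
open import Data.List.Membership.Propositional using (_∈_)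
open import Relation.Binary.PropositionalEquality using (_≡_; _≢_)

-- Bit strings {0,1}^t as Vec Bool t (false = 0, true = 1)

-- all elements of {0,1}^k, listed in lexicographic order
allBits : (k : ℕ) → List (Vec Bool k)
allBits zero = [ []ᵥ ]
allBits (suc k) = map (false ∷ᵥ_) (allBits k) ++ map (true ∷ᵥ_) (allBits k)

allVecsOf : {X : Set} → List X → (k : ℕ) → List (Vec X k)
allVecsOf xs zero = [ []ᵥ ]
allVecsOf xs (suc k) = concatMap (λ x → map (x ∷ᵥ_) (allVecsOf xs k)) xs

eqB : Bool → Bool → Bool
eqB true true = true
eqB false false = true
eqB _ _ = false

eqBits : {k : ℕ} → Vec Bool k → Vec Bool k → Bool
eqBits []ᵥ []ᵥ = true
eqBits (x ∷ᵥ xs) (y ∷ᵥ ys) = eqB x y ∧ eqBits xs ys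

ltBits : {k : ℕ} → Vec Bool k → Vec Bool k → Bool
ltBits []ᵥ []ᵥ = false
ltBits (x ∷ᵥ xs) (y ∷ᵥ ys) = if eqB x y then ltBits xs ys else (not x ∧ y)

-- P(a,b): first (1-based) position where a and b differ (only used for a ≠ b)
firstDiff : {k : ℕ} → Vec Bool k → Vec Bool k → ℕ
firstDiff []ᵥ []ᵥ = 0
firstDiff (x ∷ᵥ xs) (y ∷ᵥ ys) = if eqB x y then suc (firstDiff xs ys) else 1

-- bit of a at 1-based position i (positions out of range give false; never used)
bitAt : {k : ℕ} → Vec Bool k → ℕ → Bool
bitAt []ᵥ _ = false
bitAt (b ∷ᵥ v) zero = false
bitAt (b ∷ᵥ v) (suc zero) = b
bitAt (b ∷ᵥ v) (suc (suc i)) = bitAt v (suc i)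

between : ℕ → ℕ → List ℕ
between lo hi = map (lo +_) (upTo (suc hi ∸ lo))

data Variant : Set where
  lexicographic reversed : Variant

-- elements (a , i , z) of H
Triple : ℕ → Set
Triple t = Vec Bool t × ℕ × ℕ

-- order in which the types i ∈ {2..t} are visited for fixed a
types : Variant → ℕ → List ℕ
types lexicographic t = between 2 t
types reversed t = reverse (between 2 t)

-- H listed in increasing order w.r.t. the variant's order
Hlist : Variant → (t : ℕ) → List (Triple t)
Hlist v t = concatMap
  (λ a → concatMap
    (λ i → if bitAt a i then [] else map (λ z → (a , i , z)) (between 1 (2 ^ i)))
    (types v t))
  (allBits t)

nth : {X : Set} → List X → ℕ → Maybe X
nth [] _ = nothing
nth (x ∷ xs) zero = just x
nth (x ∷ xs) (suc k) = nth xs k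

-- admissible (0-based) positions in H of F(1): those whose a has first bit 0
startsAt : {t : ℕ} → List (Triple t) → ℕ → Bool
startsAt H j with nth H j
... | nothing = false
... | just (a , _ , _) = not (bitAt a 1)

starts : Variant → ℕ → List ℕ
starts v t = filter (λ j → startsAt (Hlist v t) j Data.Bool.≟ true) (upTo (length (Hlist v t)))
  where import Data.Bool

-- F(c+1) for a colour c : Fin d (colour c stands for c+1 ∈ {1..d}),
-- when F(1) is the element at position j of H
Fval : (v : Variant) (t : ℕ) {d : ℕ} → ℕ → Fin d → Maybe (Triple t)
Fval v t j c = nth (Hlist v t) (j + toℕ c)

-- Bipartite graphs with A = Fin m, B = Fin n, E a duplicate-free list

Edge : ℕ → ℕ → Set
Edge m n = Fin m × Fin n

eqFin : {k : ℕ} → Fin k → Fin k → Bool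
eqFin x y = toℕ x ≡ᵇ toℕ y

eqEdge : {m n : ℕ} → Edge m n → Edge m n → Bool
eqEdge (x , y) (x' , y') = eqFin x x' ∧ eqFin y y'

adjacentB : {m n : ℕ} → Edge m n → Edge m n → Bool
adjacentB (x , y) (x' , y') =
  not (eqEdge (x , y) (x' , y')) ∧ (eqFin x x' ∨ eqFin y y')

ProperColoring : {m n d : ℕ} → List (Edge m n) → (Edge m n → Fin d) → Set
ProperColoring E χ = ∀ e e' → e ∈ E → e' ∈ E → e ≢ e' →
  (proj₁ e ≡ proj₁ e' ⊎ proj₂ e ≡ proj₂ e') → χ e ≢ χ e'

-- a single outcome of the random choices:
-- j = position of F(1) in H, la = (a_x)_{x∈A}, lb = (a_y)_{y∈B}
module Outcome (v : Variant) (t d m n : ℕ) (χ : Edge m n → Fin d)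
               (j : ℕ) (la : Vec (Vec Bool t) m) (lb : Vec (Vec Bool t) n) where

  eligible : Edge m n → Bool
  eligible (x , y) with Fval v t j (χ (x , y))
  ... | nothing = false
  ... | just (a , i , z) =
    eqBits a (lookup lb y) ∧ ltBits a (lookup la x) ∧ (firstDiff a (lookup la x) ≡ᵇ i)

  typeOf : Edge m n → ℕ
  typeOf e with Fval v t j (χ e)
  ... | nothing = 0
  ... | just (a , i , z) = i

  kept : List (Edge m n) → Edge m n → Bool
  kept E e = eligible e ∧ not (any (λ e' → eligible e' ∧ adjacentB e e' ∧ (typeOf e ≡ᵇ typeOf e')) E)

  sizeE' : List (Edge m n) → ℕ
  sizeE' E = length (filter (λ e → kept E e Data.Bool.≟ true) E)
    where import Data.Bool

-- sum of |E'| over all (equally likely) outcomes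
totalKept : Variant → (t d m n : ℕ) → (Edge m n → Fin d) → List (Edge m n) → ℕ
totalKept v t d m n χ E =
  sum (map (λ j → sum (map (λ la → sum (map (λ lb → Outcome.sizeE' v t d m n χ j la lb E)
    (allVecsOf (allBits t) n))) (allVecsOf (allBits t) m))) (starts v t))

numOutcomes : Variant → (t m n : ℕ) → ℕ
numOutcomes v t m n =
  length (starts v t) * length (allVecsOf (allBits t) m) * length (allVecsOf (allBits t) n)

-- t = ⌈(log d)/2⌉ + 1  ( ⌈x/2⌉ = ⌈⌈x⌉/2⌉ )
tParam : ℕ → ℕ
tParam d = ⌈ ⌈log₂ d ⌉ /2⌉ + 1

module Submission where

-- Write t = k + 2.  Fix an edge e₀ = (x , y) and a start of F, so that F(χ(e₀)) = (a , i , z).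
-- Consider the event: a_y = a; a_x lies above a at position i (a < a_x and P(a , a_x) = i);
-- no other neighbour x' of y whose edge has class a and type i has a_x' above a at i; and no
-- other neighbour y' of x whose edge (c , i , z') has a_x above c at i has a_y' = c.  The event
-- forces e₀ ∈ E' (event⇒kept).  Labels are independent, so its probability is a product of
-- per-vertex probabilities (count-allV); as χ is proper, the rivals' edges occupy distinct
-- positions of H, so there are fewer than 2^i resp. 2^t rivals (count-by-injection), and the
-- probability is at least 2^-i · 2^-t · (p₀/q₀)² since (1 - 1/M)^(M-1) ≥ p₀/q₀ = 0.3652
-- (power-of-two-bound).  Averaging over the L admissible starts, the types met by e₀ run
-- through a period of H (Σ<-shift), which gives Pr[e₀ ∈ E'] ≥ (p₀/q₀)² (k+1)/(4L); finally
-- 4^(k+1) ≤ L ≤ 8 · 4^k ≤ 8d and 32 q₀² ≤ 240 p₀².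

open import Defs
open import Data.Nat using (ℕ; _*_; _∸_; _^_; _≤_)
open import Data.Fin using (Fin)
open import Data.List using (List; length)
open import Data.Product using (_×_)
open import Data.List.Relation.Unary.Unique.Propositional using (Unique)

open import Algebra.Properties.CommutativeSemigroup using (interchange; x∙yz≈y∙xz; x∙yz≈xz∙y; xy∙z≈xz∙y)
open import Data.Bool using (Bool; true; false; _∧_; not; if_then_else_) renaming (T to IsTrue)
import Data.Bool
open import Data.Bool.ListAction using (any)
open import Data.Bool.Properties using (∧-zeroʳ; T-≡)
open import Data.Empty using (⊥; ⊥-elim)
open import Data.Fin using (zero; suc; toℕ)
open import Data.Fin.Properties using (toℕ-injective; toℕ<n)
open import Data.List using ([]; _∷_; [_]; map; _++_; concatMap; upTo; filter; reverse; allFin)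
open import Data.List.Membership.Propositional using (_∈_; find; lose)
open import Data.List.Membership.Propositional.Properties
  using (∈-map⁺; ∈-map⁻; ∈-++⁺ˡ; ∈-++⁺ʳ; ∈-upTo⁻; ∈-filter⁺; ∈-filter⁻; ∈-concatMap⁺; ∈-concatMap⁻)
open import Data.List.Properties
  using (length-map; length-++; length-upTo; length-reverse; map-upTo; map-tabulate; map-++; map-∘; concatMap-++;
         concatMap-map; map-concatMap; concatMap-cong; reverse-applyUpTo; upTo-∷ʳ)
open import Data.List.Relation.Binary.Permutation.Propositional.Properties using (↭-reverse)
import Data.List.Relation.Binary.Permutation.Propositional.Properties as Perm
open import Data.List.Relation.Unary.All using ([]; _∷_)
import Data.List.Relation.Unary.All as All
open import Data.List.Relation.Unary.AllPairs using ([]; _∷_)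
open import Data.List.Relation.Unary.Any using (here; there)
open import Data.List.Relation.Unary.Any.Properties using (reverse⁻; any⁺; any⁻)
open import Data.List.Relation.Unary.Unique.Propositional.Properties
  using (map⁺; ++⁺; upTo⁺; applyDownFrom⁺₁; filter⁺; allFin⁺)
open import Data.Maybe using (Maybe; just; nothing)
import Data.Maybe as Maybe
open import Data.Nat
open import Data.Nat.Induction using (<-wellFounded)
open import Data.Nat.ListAction using (sum)
open import Data.Nat.ListAction.Properties using (sum-↭)
open import Data.Nat.Logarithm using (⌈log₂_⌉; ⌈log₂⌉-mono-≤; ⌈log₂2^n⌉≡n)
open import Data.Nat.Logarithm.Core using (⌈log2⌉)
open import Data.Nat.Properties
open import Data.Nat.Tactic.RingSolver using (solve-∀)
open import Data.Product using (∃; _,_; proj₁; proj₂)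
open import Data.Sum using (_⊎_; inj₁; inj₂)
open import Data.Unit using (tt)
open import Data.Vec using (Vec; lookup) renaming ([] to []ᵥ; _∷_ to _∷ᵥ_)
open import Data.Vec.Properties using (∷-injectiveʳ)
open import Function using (_∘_; id)
open import Function.Bundles using (Equivalence)
open import Induction.WellFounded using (Acc; acc)
open import Relation.Binary.PropositionalEquality hiding ([_])
open import Relation.Nullary using (yes; no)

ind : Bool → ℕ
ind true = 1
ind false = 0

Σl : {A : Set} → List A → (A → ℕ) → ℕ
Σl xs f = sum (map f xs)

Σ-++ : {A : Set} (xs ys : List A) (f : A → ℕ) → Σl (xs ++ ys) f ≡ Σl xs f + Σl ys f
Σ-++ [] ys f = refl
Σ-++ (x ∷ xs) ys f = trans (cong (f x +_) (Σ-++ xs ys f)) (sym (+-assoc (f x) _ _))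

Σ-map : {A B : Set} (h : A → B) (xs : List A) (f : B → ℕ) → Σl (map h xs) f ≡ Σl xs (f ∘ h)
Σ-map h [] f = refl
Σ-map h (x ∷ xs) f = cong (f (h x) +_) (Σ-map h xs f)

Σ-concatMap : {A B : Set} (g : A → List B) (xs : List A) (f : B → ℕ) →
  Σl (concatMap g xs) f ≡ Σl xs (λ x → Σl (g x) f)
Σ-concatMap g [] f = refl
Σ-concatMap g (x ∷ xs) f =
  trans (Σ-++ (g x) (concatMap g xs) f) (cong (Σl (g x) f +_) (Σ-concatMap g xs f))

Σ-reverse : {A : Set} (xs : List A) (f : A → ℕ) → Σl (reverse xs) f ≡ Σl xs f
Σ-reverse xs f = sum-↭ (Perm.map⁺ f (↭-reverse xs))

Σ-congIn : {A : Set} (xs : List A) {f g : A → ℕ} → (∀ x → x ∈ xs → f x ≡ g x) → Σl xs f ≡ Σl xs g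
Σ-congIn [] e = refl
Σ-congIn (x ∷ xs) e = cong₂ _+_ (e x (here refl)) (Σ-congIn xs (λ y p → e y (there p)))

Σ-cong : {A : Set} (xs : List A) {f g : A → ℕ} → (∀ x → f x ≡ g x) → Σl xs f ≡ Σl xs g
Σ-cong xs e = Σ-congIn xs (λ x _ → e x)

Σ-mono : {A : Set} (xs : List A) {f g : A → ℕ} → (∀ x → x ∈ xs → f x ≤ g x) → Σl xs f ≤ Σl xs g
Σ-mono [] e = z≤n
Σ-mono (x ∷ xs) e = +-mono-≤ (e x (here refl)) (Σ-mono xs (λ y p → e y (there p)))

Σ-add : {A : Set} (xs : List A) (f g : A → ℕ) → Σl xs (λ x → f x + g x) ≡ Σl xs f + Σl xs g
Σ-add [] f g = refl
Σ-add (x ∷ xs) f g =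
  trans (cong (f x + g x +_) (Σ-add xs f g)) (interchange +-commutativeSemigroup (f x) (g x) _ _)

Σ-zero : {A : Set} (xs : List A) (f : A → ℕ) → (∀ x → f x ≡ 0) → Σl xs f ≡ 0
Σ-zero [] f h = refl
Σ-zero (x ∷ xs) f h = cong₂ _+_ (h x) (Σ-zero xs f h)

Σ-swap : {A B : Set} (xs : List A) (ys : List B) (f : A → B → ℕ) →
  Σl xs (λ x → Σl ys (f x)) ≡ Σl ys (λ y → Σl xs (λ x → f x y))
Σ-swap [] ys f = sym (Σ-zero ys _ (λ _ → refl))
Σ-swap (x ∷ xs) ys f =
  trans (cong (Σl ys (f x) +_) (Σ-swap xs ys f)) (sym (Σ-add ys (f x) (λ y → Σl xs (λ x' → f x' y))))

Σ-scale : {A : Set} (xs : List A) (c : ℕ) (f : A → ℕ) → Σl xs (λ x → c * f x) ≡ c * Σl xs f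
Σ-scale [] c f = sym (*-zeroʳ c)
Σ-scale (x ∷ xs) c f = trans (cong (c * f x +_) (Σ-scale xs c f)) (sym (*-distribˡ-+ c (f x) _))

Σ-scaleʳ : {A : Set} (xs : List A) (c : ℕ) (f : A → ℕ) → Σl xs (λ x → f x * c) ≡ Σl xs f * c
Σ-scaleʳ xs c f = trans (Σ-cong xs (λ x → *-comm (f x) c)) (trans (Σ-scale xs c f) (*-comm c _))

Σ-const : {A : Set} (xs : List A) (c : ℕ) → Σl xs (λ _ → c) ≡ length xs * c
Σ-const [] c = refl
Σ-const (x ∷ xs) c = cong (c +_) (Σ-const xs c)

Σ-one : {A : Set} (xs : List A) → Σl xs (λ _ → 1) ≡ length xs
Σ-one xs = trans (Σ-const xs 1) (*-identityʳ _)

Σ-filter : {A : Set} (f : A → Bool) (xs : List A) (h : A → ℕ) →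
  Σl (filter (λ x → f x Data.Bool.≟ true) xs) h ≡ Σl xs (λ x → ind (f x) * h x)
Σ-filter f [] h = refl
Σ-filter f (x ∷ xs) h with f x
... | true = cong₂ _+_ (sym (+-identityʳ (h x))) (Σ-filter f xs h)
... | false = Σ-filter f xs h

length-filter : {A : Set} (f : A → Bool) (xs : List A) →
  length (filter (λ x → f x Data.Bool.≟ true) xs) ≡ Σl xs (ind ∘ f)
length-filter f xs =
  trans (sym (Σ-one (filter _ xs))) (trans (Σ-filter f xs (λ _ → 1)) (Σ-cong xs (λ x → *-identityʳ _)))

length-concatMap : {A B : Set} (f : A → List B) (xs : List A) →
  length (concatMap f xs) ≡ Σl xs (λ x → length (f x))
length-concatMap f xs =
  trans (sym (Σ-one (concatMap f xs))) (trans (Σ-concatMap f xs (λ _ → 1)) (Σ-cong xs (Σ-one ∘ f)))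

∈-concatMap-intro : {A B : Set} (f : A → List B) {xs : List A} {x : A} {b : B} →
  x ∈ xs → b ∈ f x → b ∈ concatMap f xs
∈-concatMap-intro f x∈xs b∈fx = ∈-concatMap⁺ f (lose x∈xs b∈fx)

∈-concatMap-elim : {A B : Set} (f : A → List B) (xs : List A) {b : B} →
  b ∈ concatMap f xs → ∃ λ x → x ∈ xs × b ∈ f x
∈-concatMap-elim f xs p = find (∈-concatMap⁻ f p)

∧-true₁ : ∀ {b c} → b ∧ c ≡ true → b ≡ true
∧-true₁ {true} e = refl

∧-true₂ : ∀ b {c} → b ∧ c ≡ true → c ≡ true
∧-true₂ true e = e

∧-intro : ∀ {b c} → b ≡ true → c ≡ true → b ∧ c ≡ true
∧-intro refl refl = refl

≡ᵇ-sound : ∀ m n → (m ≡ᵇ n) ≡ true → m ≡ n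
≡ᵇ-sound m n e = ≡ᵇ⇒≡ m n (subst IsTrue (sym e) tt)

≡ᵇ-refl : ∀ n → (n ≡ᵇ n) ≡ true
≡ᵇ-refl zero = refl
≡ᵇ-refl (suc n) = ≡ᵇ-refl n

eqFin-sound : ∀ {k} (a b : Fin k) → eqFin a b ≡ true → a ≡ b
eqFin-sound a b e = toℕ-injective (≡ᵇ-sound (toℕ a) (toℕ b) e)

eqFin-refl : ∀ {k} (a : Fin k) → eqFin a a ≡ true
eqFin-refl a = ≡ᵇ-refl (toℕ a)

module _ {A : Set} where

  private
    remove : {x : A} (ys : List A) → x ∈ ys → List A
    remove (y ∷ ys) (here _) = ys
    remove (y ∷ ys) (there p) = y ∷ remove ys p

    length-remove : {x : A} (ys : List A) (p : x ∈ ys) → suc (length (remove ys p)) ≡ length ys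
    length-remove (y ∷ ys) (here _) = refl
    length-remove (y ∷ ys) (there p) = cong suc (length-remove ys p)

    ∈-remove : {x z : A} (ys : List A) (p : x ∈ ys) → z ∈ ys → z ≢ x → z ∈ remove ys p
    ∈-remove (y ∷ ys) (here refl) (here refl) z≢x = ⊥-elim (z≢x refl)
    ∈-remove (y ∷ ys) (here refl) (there q) z≢x = q
    ∈-remove (y ∷ ys) (there p) (here refl) z≢x = here refl
    ∈-remove (y ∷ ys) (there p) (there q) z≢x = there (∈-remove ys p q z≢x)

  pigeonhole : (xs ys : List A) → Unique xs → (∀ z → z ∈ xs → z ∈ ys) → length xs ≤ length ys
  pigeonhole [] ys u sub = z≤n
  pigeonhole (x ∷ xs) ys (x∉xs ∷ u) sub =
    subst (suc (length xs) ≤_) (length-remove ys x∈ys) (s≤s (pigeonhole xs (remove ys x∈ys) u sub′))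
    where
    x∈ys : x ∈ ys
    x∈ys = sub x (here refl)
    sub′ : ∀ z → z ∈ xs → z ∈ remove ys x∈ys
    sub′ z z∈xs = ∈-remove ys x∈ys (sub z (there z∈xs)) (λ z≡x → All.lookup x∉xs z∈xs (sym z≡x))

  pigeonhole-strict : (w : A) (xs ys : List A) → Unique xs → (∀ z → z ∈ xs → z ∈ ys) → w ∈ ys →
    (∀ z → z ∈ xs → z ≢ w) → suc (length xs) ≤ length ys
  pigeonhole-strict w xs ys u sub w∈ys fresh =
    pigeonhole (w ∷ xs) ys (All.tabulate (λ z∈xs w≡z → fresh _ z∈xs (sym w≡z)) ∷ u) sub′
    where
    sub′ : ∀ z → z ∈ w ∷ xs → z ∈ ys
    sub′ z (here refl) = w∈ys
    sub′ z (there z∈xs) = sub z z∈xs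

  unique-map-injectiveOn : {B : Set} (f : A → B) (xs : List A) → Unique xs →
    (∀ a b → a ∈ xs → b ∈ xs → f a ≡ f b → a ≡ b) → Unique (map f xs)
  unique-map-injectiveOn f [] u inj = []
  unique-map-injectiveOn f (x ∷ xs) (x∉xs ∷ u) inj =
    All.tabulate fresh ∷ unique-map-injectiveOn f xs u (λ a b p q → inj a b (there p) (there q))
    where
    fresh : ∀ {w} → w ∈ map f xs → f x ≢ w
    fresh w∈ fx≡w with ∈-map⁻ f w∈
    ... | b , b∈xs , refl = All.lookup x∉xs b∈xs (inj x b (here refl) (there b∈xs) fx≡w)

  unique-concatMap : {B : Set} (f : A → List B) (xs : List A) → Unique xs → (∀ x → Unique (f x)) →
    (∀ x y {b} → b ∈ f x → b ∈ f y → x ≡ y) → Unique (concatMap f xs)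
  unique-concatMap f [] u uf key = []
  unique-concatMap f (x ∷ xs) (x∉xs ∷ u) uf key = ++⁺ (uf x) (unique-concatMap f xs u uf key) disjoint
    where
    disjoint : ∀ {b} → b ∈ f x × b ∈ concatMap f xs → ⊥
    disjoint (p , q) with ∈-concatMap-elim f xs q
    ... | y , y∈xs , r = All.lookup x∉xs y∈xs (key x y p r)

count-by-injection : {K B : Set} (ks : List K) → Unique ks → (f : K → Bool) (g : K → B) (tgt : List B) (w : B) →
  (∀ k k' → f k ≡ true → f k' ≡ true → g k ≡ g k' → k ≡ k') →
  (∀ k → f k ≡ true → g k ∈ tgt) → w ∈ tgt → (∀ k → f k ≡ true → g k ≢ w) →
  suc (Σl ks (ind ∘ f)) ≤ length tgt
count-by-injection ks u f g tgt w inj into w∈ avoid =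
  subst (λ l → suc l ≤ length tgt) (trans (length-map g selected) (length-filter f ks))
        (pigeonhole-strict w (map g selected) tgt unique-images images-in w∈ fresh)
  where
  selected = filter (λ k → f k Data.Bool.≟ true) ks
  is-selected : ∀ {k} → k ∈ selected → f k ≡ true
  is-selected p = proj₂ (∈-filter⁻ (λ k → f k Data.Bool.≟ true) {xs = ks} p)
  unique-images : Unique (map g selected)
  unique-images = unique-map-injectiveOn g selected (filter⁺ (λ k → f k Data.Bool.≟ true) u)
                    (λ a b p q → inj a b (is-selected p) (is-selected q))
  images-in : ∀ b → b ∈ map g selected → b ∈ tgt
  images-in b p with ∈-map⁻ g p
  ... | k , k∈ , refl = into k (is-selected k∈)
  fresh : ∀ b → b ∈ map g selected → b ≢ w
  fresh b p with ∈-map⁻ g p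
  ... | k , k∈ , refl = avoid k (is-selected k∈)

<⇒≤∸1 : ∀ {a b} → a < b → a ≤ b ∸ 1
<⇒≤∸1 (s≤s a≤) = a≤

length-allBits : ∀ k → length (allBits k) ≡ 2 ^ k
length-allBits zero = refl
length-allBits (suc k) = begin
  length (map (false ∷ᵥ_) (allBits k) ++ map (true ∷ᵥ_) (allBits k))
    ≡⟨ length-++ (map (false ∷ᵥ_) (allBits k)) ⟩
  length (map (false ∷ᵥ_) (allBits k)) + length (map (true ∷ᵥ_) (allBits k))
    ≡⟨ cong₂ _+_ (length-map _ (allBits k)) (length-map _ (allBits k)) ⟩
  length (allBits k) + length (allBits k)
    ≡⟨ cong₂ _+_ (length-allBits k) (trans (length-allBits k) (sym (+-identityʳ _))) ⟩
  2 ^ suc k ∎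
  where open ≡-Reasoning

Σ-allBits-one : ∀ k → Σl (allBits k) (λ _ → 1) ≡ 2 ^ k
Σ-allBits-one k = trans (Σ-one (allBits k)) (length-allBits k)

Σ-allBits : ∀ k (f : Vec Bool (suc k) → ℕ) →
  Σl (allBits (suc k)) f ≡ Σl (allBits k) (f ∘ (false ∷ᵥ_)) + Σl (allBits k) (f ∘ (true ∷ᵥ_))
Σ-allBits k f = trans (Σ-++ (map (false ∷ᵥ_) (allBits k)) _ f)
  (cong₂ _+_ (Σ-map _ (allBits k) f) (Σ-map _ (allBits k) f))

Σ-allBits-head : ∀ k (y : Bool) (f : Vec Bool (suc k) → ℕ) (g : Vec Bool k → ℕ) →
  (∀ u → f (y ∷ᵥ u) ≡ g u) → (∀ u → f (not y ∷ᵥ u) ≡ 0) → Σl (allBits (suc k)) f ≡ Σl (allBits k) g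
Σ-allBits-head k true f g on off =
  trans (Σ-allBits k f) (cong₂ _+_ (Σ-zero (allBits k) _ off) (Σ-cong (allBits k) on))
Σ-allBits-head k false f g on off =
  trans (Σ-allBits k f) (trans (cong₂ _+_ (Σ-cong (allBits k) on) (Σ-zero (allBits k) _ off)) (+-identityʳ _))

∈-allBits : ∀ {k} (u : Vec Bool k) → u ∈ allBits k
∈-allBits []ᵥ = here refl
∈-allBits {suc k} (false ∷ᵥ u) = ∈-++⁺ˡ (∈-map⁺ (false ∷ᵥ_) (∈-allBits u))
∈-allBits {suc k} (true ∷ᵥ u) = ∈-++⁺ʳ (map (false ∷ᵥ_) (allBits k)) (∈-map⁺ (true ∷ᵥ_) (∈-allBits u))

unique-allBits : ∀ k → Unique (allBits k)
unique-allBits zero = [] ∷ []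
unique-allBits (suc k) = ++⁺ (map⁺ ∷-injectiveʳ (unique-allBits k)) (map⁺ ∷-injectiveʳ (unique-allBits k)) disjoint
  where
  disjoint : ∀ {v} → v ∈ map (false ∷ᵥ_) (allBits k) × v ∈ map (true ∷ᵥ_) (allBits k) → ⊥
  disjoint (p , q) with ∈-map⁻ (false ∷ᵥ_) p | ∈-map⁻ (true ∷ᵥ_) q
  ... | _ , _ , refl | _ , _ , ()

eqBits-sound : ∀ {k} (u v : Vec Bool k) → eqBits u v ≡ true → u ≡ v
eqBits-sound []ᵥ []ᵥ e = refl
eqBits-sound (true ∷ᵥ u) (true ∷ᵥ v) e = cong (true ∷ᵥ_) (eqBits-sound u v e)
eqBits-sound (false ∷ᵥ u) (false ∷ᵥ v) e = cong (false ∷ᵥ_) (eqBits-sound u v e)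

eqBits-refl : ∀ {k} (u : Vec Bool k) → eqBits u u ≡ true
eqBits-refl []ᵥ = refl
eqBits-refl (true ∷ᵥ u) = eqBits-refl u
eqBits-refl (false ∷ᵥ u) = eqBits-refl u

count-equal : ∀ k (a : Vec Bool k) → Σl (allBits k) (λ u → ind (eqBits a u)) ≡ 1
count-equal zero []ᵥ = refl
count-equal (suc k) (x ∷ᵥ a) = trans (Σ-allBits-head k x _ _ (on x) (off x)) (count-equal k a)
  where
  on : ∀ x u → ind (eqBits (x ∷ᵥ a) (x ∷ᵥ u)) ≡ ind (eqBits a u)
  on true u = refl
  on false u = refl
  off : ∀ x u → ind (eqBits (x ∷ᵥ a) (not x ∷ᵥ u)) ≡ 0
  off true u = refl
  off false u = refl

Σ-ind-not : {A : Set} (xs : List A) (f : A → Bool) →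
  Σl xs (λ u → ind (not (f u))) + Σl xs (ind ∘ f) ≡ length xs
Σ-ind-not xs f = trans (sym (Σ-add xs _ _)) (trans (Σ-cong xs (λ u → complement (f u))) (Σ-one xs))
  where
  complement : ∀ b → ind (not b) + ind b ≡ 1
  complement true = refl
  complement false = refl

-- above a i u: a < u lexicographically and P(a,u) = i, i.e. u is a valid a_x for an edge of
-- class a and type i.  Equivalently a <-precedes u, branching at position i.
above : ∀ {k} → Vec Bool k → ℕ → Vec Bool k → Bool
above a i u = ltBits a u ∧ (firstDiff a u ≡ᵇ i)

above-0 : ∀ {k} (a u : Vec Bool k) → above a 0 u ≡ false
above-0 []ᵥ []ᵥ = refl
above-0 (x ∷ᵥ a) (y ∷ᵥ u) with eqB x y
... | true = ∧-zeroʳ _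
... | false = ∧-zeroʳ _

above-step : ∀ {k} x (a u : Vec Bool k) i → above (x ∷ᵥ a) (2 + i) (x ∷ᵥ u) ≡ above a (suc i) u
above-step true a u i = refl
above-step false a u i = refl

above-missʳ : ∀ {k} x (a u : Vec Bool k) i → above (x ∷ᵥ a) (2 + i) (not x ∷ᵥ u) ≡ false
above-missʳ true a u i = refl
above-missʳ false a u i = refl

above-missˡ : ∀ {k} y (c b : Vec Bool k) i → above (not y ∷ᵥ c) (2 + i) (y ∷ᵥ b) ≡ false
above-missˡ true c b i = refl
above-missˡ false c b i = refl

count-above : ∀ k i (a : Vec Bool k) → 1 ≤ i → i ≤ k → bitAt a i ≡ false →
  Σl (allBits k) (λ u → ind (above a i u)) * 2 ^ i ≡ 2 ^ k
count-above (suc k) 1 (false ∷ᵥ a) _ _ refl =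
  trans (cong (_* 2) (trans (Σ-allBits-head k true _ (λ _ → 1) (λ u → refl) (λ u → cong ind (above-0 a u)))
                            (Σ-allBits-one k)))
        (*-comm (2 ^ k) 2)
count-above (suc k) (suc (suc i)) (x ∷ᵥ a) _ (s≤s i<k) bit =
  begin
    Σl (allBits (suc k)) (λ u → ind (above (x ∷ᵥ a) (2 + i) u)) * 2 ^ (2 + i)
  ≡⟨ cong (_* 2 ^ (2 + i)) (Σ-allBits-head k x _ _ (λ u → cong ind (above-step x a u i))
                                                  (λ u → cong ind (above-missʳ x a u i))) ⟩
    C * (2 * 2 ^ suc i)
  ≡⟨ x∙yz≈y∙xz *-commutativeSemigroup C 2 (2 ^ suc i) ⟩
    2 * (C * 2 ^ suc i)
  ≡⟨ cong (2 *_) (count-above k (suc i) a (s≤s z≤n) i<k bit) ⟩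
    2 ^ suc k
  ∎
  where
  open ≡-Reasoning
  C : ℕ
  C = Σl (allBits k) (λ u → ind (above a (suc i) u))

count-below : ∀ k i (b : Vec Bool k) → 1 ≤ i → i ≤ k →
  Σl (allBits k) (λ c → ind (above c i b)) * 2 ^ i ≤ 2 ^ k
count-below (suc k) 1 (true ∷ᵥ b) _ _ = ≤-reflexive
  (trans (cong (_* 2) (trans (Σ-allBits-head k false _ (λ _ → 1) (λ c → refl) (λ c → cong ind (above-0 c b)))
                             (Σ-allBits-one k)))
         (*-comm (2 ^ k) 2))
count-below (suc k) 1 (false ∷ᵥ b) _ _ = ≤-trans (≤-reflexive (cong (_* 2) nothingBelow)) z≤n
  where
  nothingBelow : Σl (allBits (suc k)) (λ c → ind (above c 1 (false ∷ᵥ b))) ≡ 0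
  nothingBelow = trans (Σ-allBits-head k false _ (λ _ → 0) (λ c → cong ind (above-0 c b)) (λ c → refl))
                       (Σ-zero (allBits k) _ (λ _ → refl))
count-below (suc k) (suc (suc i)) (y ∷ᵥ b) _ (s≤s i<k) =
  begin
    Σl (allBits (suc k)) (λ c → ind (above c (2 + i) (y ∷ᵥ b))) * 2 ^ (2 + i)
  ≡⟨ cong (_* 2 ^ (2 + i)) (Σ-allBits-head k y _ _ (λ c → cong ind (above-step y c b i))
                                                   (λ c → cong ind (above-missˡ y c b i))) ⟩
    C * (2 * 2 ^ suc i)
  ≡⟨ x∙yz≈y∙xz *-commutativeSemigroup C 2 (2 ^ suc i) ⟩
    2 * (C * 2 ^ suc i)
  ≤⟨ *-monoʳ-≤ 2 (count-below k (suc i) b (s≤s z≤n) i<k) ⟩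
    2 ^ suc k
  ∎
  where
  open ≤-Reasoning
  C : ℕ
  C = Σl (allBits k) (λ c → ind (above c (suc i) b))

count-zeroBit : ∀ k r → r ≤ k → Σl (allBits (suc k)) (λ a → ind (not (bitAt a (suc r)))) ≡ 2 ^ k
count-zeroBit k zero _ = trans (Σ-allBits-head k false _ (λ _ → 1) (λ _ → refl) (λ _ → refl)) (Σ-allBits-one k)
count-zeroBit (suc k) (suc r) (s≤s r≤k) =
  trans (Σ-allBits (suc k) _)
        (trans (cong₂ _+_ (count-zeroBit k r r≤k) (count-zeroBit k r r≤k)) (cong (2 ^ k +_) (sym (+-identityʳ _))))

between-mem : ∀ lo hi {x} → x ∈ between lo hi → lo ≤ x × x ≤ hi
between-mem lo hi p with ∈-map⁻ (lo +_) p
... | u , u∈ , refl = m≤m+n lo u , bounded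
  where
  u< : u < suc hi ∸ lo
  u< = ∈-upTo⁻ u∈
  bounded : lo + u ≤ hi
  bounded with lo ≤? suc hi
  ... | yes lo≤ = ≤-pred (subst (lo + u <_) (m+[n∸m]≡n lo≤) (+-monoʳ-< lo u<))
  ... | no lo≰ = ⊥-elim (n≮0 (subst (u <_) (m≤n⇒m∸n≡0 (≰⇒≥ lo≰)) u<))

between-unique : ∀ lo hi → Unique (between lo hi)
between-unique lo hi = map⁺ (+-cancelˡ-≡ lo _ _) (upTo⁺ (suc hi ∸ lo))

length-between1 : ∀ n → length (between 1 n) ≡ n
length-between1 n = trans (length-map (1 +_) (upTo n)) (length-upTo n)

types-mem : ∀ v t {i} → i ∈ types v t → 2 ≤ i × i ≤ t
types-mem lexicographic t p = between-mem 2 t p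
types-mem reversed t p = between-mem 2 t (reverse⁻ p)

types-unique : ∀ v t → Unique (types v t)
types-unique lexicographic t = between-unique 2 t
types-unique reversed t =
  subst Unique (sym (trans (cong reverse (map-upTo (2 +_) (suc t ∸ 2))) (reverse-applyUpTo (2 +_) (suc t ∸ 2))))
        (applyDownFrom⁺₁ (2 +_) (suc t ∸ 2) (λ j<i _ e → <⇒≢ j<i (sym (+-cancelˡ-≡ 2 _ _ e))))

length-types : ∀ v t → length (types v t) ≡ suc t ∸ 2
length-types lexicographic t = trans (length-map (2 +_) (upTo (suc t ∸ 2))) (length-upTo (suc t ∸ 2))
length-types reversed t = trans (length-reverse (between 2 t)) (length-types lexicographic t)

Σ-types : ∀ v t (f : ℕ → ℕ) → Σl (types v t) f ≡ Σl (between 2 t) f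
Σ-types lexicographic t f = refl
Σ-types reversed t f = Σ-reverse (between 2 t) f

cls : ∀ {t} → Triple t → Vec Bool t
cls (a , i , z) = a

typ : ∀ {t} → Triple t → ℕ
typ (a , i , z) = i

idx : ∀ {t} → Triple t → ℕ
idx (a , i , z) = z

-- The structure of H for t = k + 2.  H is the concatenation of blocks, one per class a, and the
-- block of a consists of cells, one per type i with a_i = 0, of 2^i elements each.
module Hstructure (v : Variant) (k : ℕ) where

  T : ℕ
  T = suc (suc k)

  cell : Vec Bool T → ℕ → List (Triple T)
  cell a i = if bitAt a i then [] else map (λ z → (a , i , z)) (between 1 (2 ^ i))

  block : Vec Bool T → List (Triple T)
  block a = concatMap (cell a) (types v T)

  H : List (Triple T)
  H = Hlist v T

  cell-mem : ∀ a i {τ} → τ ∈ cell a i →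
    τ ≡ (a , i , idx τ) × bitAt a i ≡ false × idx τ ∈ between 1 (2 ^ i)
  cell-mem a i p with bitAt a i
  ... | true with () ← p
  ... | false with ∈-map⁻ (λ z → (a , i , z)) p
  ... | z , z∈ , refl = refl , refl , z∈

  block-mem : ∀ a {τ} → τ ∈ block a →
    τ ≡ (a , typ τ , idx τ) × typ τ ∈ types v T × bitAt a (typ τ) ≡ false × idx τ ∈ between 1 (2 ^ typ τ)
  block-mem a p with ∈-concatMap-elim (cell a) (types v T) p
  ... | i , i∈ , q with cell-mem a i q
  ... | refl , bit , z∈ = refl , i∈ , bit , z∈

  H-mem : ∀ {τ} → τ ∈ H → typ τ ∈ types v T × bitAt (cls τ) (typ τ) ≡ false × idx τ ∈ between 1 (2 ^ typ τ)
  H-mem p with ∈-concatMap-elim block (allBits T) p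
  ... | a , _ , q with block-mem a q
  ... | refl , i∈ , bit , z∈ = i∈ , bit , z∈

  -- H is duplicate-free: the class and the type of an element locate its block and cell.
  H-unique : Unique H
  H-unique = unique-concatMap block (allBits T) (unique-allBits T)
    (λ a → unique-concatMap (cell a) (types v T) (types-unique v T) (cell-unique a)
             (λ i j p q → trans (sym (cong typ (proj₁ (cell-mem a i p)))) (cong typ (proj₁ (cell-mem a j q)))))
    (λ a b p q → trans (sym (cong cls (proj₁ (block-mem a p)))) (cong cls (proj₁ (block-mem b q))))
    where
    cell-unique : ∀ a i → Unique (cell a i)
    cell-unique a i with bitAt a i
    ... | true = []
    ... | false = map⁺ (λ { refl → refl }) (between-unique 1 (2 ^ i))

  -- H splits into the classes with first bit 0 (the admissible starting points) and 1.
  H₀ H₁ : List (Triple T)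
  H₀ = concatMap block (map (false ∷ᵥ_) (allBits (suc k)))
  H₁ = concatMap block (map (true ∷ᵥ_) (allBits (suc k)))

  H-split : H ≡ H₀ ++ H₁
  H-split = concatMap-++ block (map (false ∷ᵥ_) (allBits (suc k))) (map (true ∷ᵥ_) (allBits (suc k)))

  H₀-firstBit : ∀ {τ} → τ ∈ H₀ → bitAt (cls τ) 1 ≡ false
  H₀-firstBit p with ∈-concatMap-elim block (map (false ∷ᵥ_) (allBits (suc k))) p
  ... | a , a∈ , q with ∈-map⁻ (false ∷ᵥ_) a∈ | block-mem a q
  ... | _ , _ , refl | refl , _ = refl

  H₁-firstBit : ∀ {τ} → τ ∈ H₁ → bitAt (cls τ) 1 ≡ true
  H₁-firstBit p with ∈-concatMap-elim block (map (true ∷ᵥ_) (allBits (suc k))) p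
  ... | a , a∈ , q with ∈-map⁻ (true ∷ᵥ_) a∈ | block-mem a q
  ... | _ , _ , refl | refl , _ = refl

  -- Since types are ≥ 2, the first bit of a class does not influence the shape of its block:
  -- both halves of H have the same sequence of types.
  types-H₀≡H₁ : map typ H₀ ≡ map typ H₁
  types-H₀≡H₁ =
    trans (map-concatMap typ block (map (false ∷ᵥ_) A))
    (trans (concatMap-map (map typ ∘ block) (false ∷ᵥ_) A)
    (trans (concatMap-cong (λ a → types-block a (types v T) (λ i p → proj₁ (types-mem v T p))) A)
    (trans (sym (concatMap-map (map typ ∘ block) (true ∷ᵥ_) A))
           (sym (map-concatMap typ block (map (true ∷ᵥ_) A))))))
    where
    A = allBits (suc k)
    types-cell : ∀ a i → 2 ≤ i → map typ (cell (false ∷ᵥ a) i) ≡ map typ (cell (true ∷ᵥ a) i)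
    types-cell a (suc zero) (s≤s ())
    types-cell a (suc (suc i)) _ with bitAt a (suc i)
    ... | true = refl
    ... | false = trans (sym (map-∘ (between 1 (2 ^ (2 + i))))) (map-∘ (between 1 (2 ^ (2 + i))))
    types-block : ∀ a (is : List ℕ) → (∀ i → i ∈ is → 2 ≤ i) →
      map typ (concatMap (cell (false ∷ᵥ a)) is) ≡ map typ (concatMap (cell (true ∷ᵥ a)) is)
    types-block a [] _ = refl
    types-block a (i ∷ is) ok =
      trans (map-++ typ (cell (false ∷ᵥ a) i) _)
      (trans (cong₂ _++_ (types-cell a i (ok i (here refl))) (types-block a is (λ j p → ok j (there p))))
             (sym (map-++ typ (cell (true ∷ᵥ a) i) _)))

  length-H₁ : length H₁ ≡ length H₀
  length-H₁ = trans (sym (length-map typ H₁)) (trans (cong length (sym types-H₀≡H₁)) (length-map typ H₀))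

  -- Weighted count of H₀ by type: each type i occurs 2^i times in each of the 2^k blocks
  -- of classes with first bit 0 and a_i = 0.
  Σ-H₀ : (h : ℕ → ℕ) → Σl H₀ (h ∘ typ) ≡ 2 ^ k * Σl (types v T) (λ i → 2 ^ i * h i)
  Σ-H₀ h =
    begin
      Σl H₀ (h ∘ typ)
    ≡⟨ Σ-concatMap block (map (false ∷ᵥ_) A) (h ∘ typ) ⟩
      Σl (map (false ∷ᵥ_) A) (λ a → Σl (block a) (h ∘ typ))
    ≡⟨ Σ-map (false ∷ᵥ_) A _ ⟩
      Σl A (λ a → Σl (block (false ∷ᵥ a)) (h ∘ typ))
    ≡⟨ Σ-cong A (λ a → trans (Σ-concatMap (cell (false ∷ᵥ a)) (types v T) (h ∘ typ))
                             (Σ-cong (types v T) (Σ-cell (false ∷ᵥ a)))) ⟩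
      Σl A (λ a → Σl (types v T) (λ i → ind (not (bitAt (false ∷ᵥ a) i)) * (2 ^ i * h i)))
    ≡⟨ Σ-swap A (types v T) _ ⟩
      Σl (types v T) (λ i → Σl A (λ a → ind (not (bitAt (false ∷ᵥ a) i)) * (2 ^ i * h i)))
    ≡⟨ Σ-congIn (types v T) per-type ⟩
      Σl (types v T) (λ i → 2 ^ k * (2 ^ i * h i))
    ≡⟨ Σ-scale (types v T) (2 ^ k) _ ⟩
      2 ^ k * Σl (types v T) (λ i → 2 ^ i * h i)
    ∎
    where
    open ≡-Reasoning
    A = allBits (suc k)
    Σ-cell : ∀ a i → Σl (cell a i) (h ∘ typ) ≡ ind (not (bitAt a i)) * (2 ^ i * h i)
    Σ-cell a i with bitAt a i
    ... | true = refl
    ... | false = trans (Σ-map (λ z → (a , i , z)) (between 1 (2 ^ i)) (h ∘ typ))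
                  (trans (Σ-const (between 1 (2 ^ i)) (h i))
                         (trans (cong (_* h i) (length-between1 (2 ^ i))) (sym (+-identityʳ _))))
    per-type : ∀ i → i ∈ types v T →
      Σl A (λ a → ind (not (bitAt (false ∷ᵥ a) i)) * (2 ^ i * h i)) ≡ 2 ^ k * (2 ^ i * h i)
    per-type i i∈ with types-mem v T i∈
    ... | s≤s (s≤s {n = r} _) , s≤s (s≤s r≤k) =
      trans (Σ-scaleʳ A (2 ^ i * h i) (λ a → ind (not (bitAt a (suc r)))))
            (cong (_* (2 ^ i * h i)) (count-zeroBit k r r≤k))

nth-++ˡ : {A : Set} (xs ys : List A) (p : ℕ) → p < length xs → nth (xs ++ ys) p ≡ nth xs p
nth-++ˡ (x ∷ xs) ys zero _ = refl
nth-++ˡ (x ∷ xs) ys (suc p) (s≤s p<) = nth-++ˡ xs ys p p<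

nth-++ʳ : {A : Set} (xs ys : List A) (q : ℕ) → nth (xs ++ ys) (length xs + q) ≡ nth ys q
nth-++ʳ [] ys q = refl
nth-++ʳ (x ∷ xs) ys q = nth-++ʳ xs ys q

nth-defined : {A : Set} (xs : List A) (p : ℕ) → p < length xs → ∃ λ τ → nth xs p ≡ just τ
nth-defined (x ∷ xs) zero _ = x , refl
nth-defined (x ∷ xs) (suc p) (s≤s p<) = nth-defined xs p p<

nth-∈ : {A : Set} (xs : List A) (p : ℕ) {τ : A} → nth xs p ≡ just τ → τ ∈ xs
nth-∈ (x ∷ xs) zero refl = here refl
nth-∈ (x ∷ xs) (suc p) e = there (nth-∈ xs p e)

nth-map : {A B : Set} (f : A → B) (xs : List A) (p : ℕ) → nth (map f xs) p ≡ Maybe.map f (nth xs p)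
nth-map f [] p = refl
nth-map f (x ∷ xs) zero = refl
nth-map f (x ∷ xs) (suc p) = nth-map f xs p

nth-injective : {A : Set} (xs : List A) → Unique xs → ∀ p q {τ : A} →
  nth xs p ≡ just τ → nth xs q ≡ just τ → p ≡ q
nth-injective (x ∷ xs) u zero zero e₁ e₂ = refl
nth-injective (x ∷ xs) (x∉xs ∷ u) zero (suc q) refl e₂ = ⊥-elim (All.lookup x∉xs (nth-∈ xs q e₂) refl)
nth-injective (x ∷ xs) (x∉xs ∷ u) (suc p) zero e₁ refl = ⊥-elim (All.lookup x∉xs (nth-∈ xs p e₁) refl)
nth-injective (x ∷ xs) (_ ∷ u) (suc p) (suc q) e₁ e₂ = cong suc (nth-injective xs u p q e₁ e₂)

Σ< : ℕ → (ℕ → ℕ) → ℕ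
Σ< n g = Σl (upTo n) g

Σ<-suc : ∀ n g → Σ< (suc n) g ≡ g 0 + Σ< n (g ∘ suc)
Σ<-suc n g = cong (g 0 +_) (trans (cong (λ l → Σl l g) (sym (map-upTo suc n))) (Σ-map suc (upTo n) g))

Σ<-nth : {A : Set} (h : Maybe A → ℕ) (xs : List A) → Σ< (length xs) (λ p → h (nth xs p)) ≡ Σl xs (h ∘ just)
Σ<-nth h [] = refl
Σ<-nth h (x ∷ xs) = trans (Σ<-suc (length xs) (λ p → h (nth (x ∷ xs) p))) (cong (h (just x) +_) (Σ<-nth h xs))

Σ<-+ : ∀ a b g → Σ< (a + b) g ≡ Σ< a g + Σ< b (λ j → g (a + j))
Σ<-+ zero b g = refl
Σ<-+ (suc a) b g =
  trans (Σ<-suc (a + b) g)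
  (trans (cong (g 0 +_) (Σ<-+ a b (g ∘ suc)))
  (trans (sym (+-assoc (g 0) _ _)) (cong (_+ Σ< b (λ j → g (suc a + j))) (sym (Σ<-suc a g)))))

Σ<-cong : ∀ n {f g : ℕ → ℕ} → (∀ j → j < n → f j ≡ g j) → Σ< n f ≡ Σ< n g
Σ<-cong n e = Σ-congIn (upTo n) (λ j j∈ → e j (∈-upTo⁻ j∈))

Σ<-mono : ∀ n {f g : ℕ → ℕ} → (∀ j → j < n → f j ≤ g j) → Σ< n f ≤ Σ< n g
Σ<-mono n e = Σ-mono (upTo n) (λ j j∈ → e j (∈-upTo⁻ j∈))

Σ<-shift : ∀ L c (w : ℕ → ℕ) → c ≤ L → (∀ p → p < c → w (L + p) ≡ w p) →
  Σ< L (λ j → w (j + c)) ≡ Σ< L w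
Σ<-shift L c w c≤L periodic =
  begin
    Σ< L (λ j → w (j + c))
  ≡⟨ cong (λ n → Σ< n (λ j → w (j + c))) (sym split) ⟩
    Σ< (L ∸ c + c) (λ j → w (j + c))
  ≡⟨ Σ<-+ (L ∸ c) c _ ⟩
    Σ< (L ∸ c) (λ j → w (j + c)) + Σ< c (λ j → w (L ∸ c + j + c))
  ≡⟨ cong₂ _+_ (Σ<-cong (L ∸ c) (λ j _ → cong w (+-comm j c)))
               (Σ<-cong c (λ j j<c → trans (cong w (wrap j)) (periodic j j<c))) ⟩
    Σ< (L ∸ c) (λ j → w (c + j)) + Σ< c w
  ≡⟨ +-comm _ (Σ< c w) ⟩
    Σ< c w + Σ< (L ∸ c) (λ j → w (c + j))
  ≡⟨ sym (Σ<-+ c (L ∸ c) w) ⟩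
    Σ< (c + (L ∸ c)) w
  ≡⟨ cong (λ n → Σ< n w) (m+[n∸m]≡n c≤L) ⟩
    Σ< L w
  ∎
  where
  open ≡-Reasoning
  split : L ∸ c + c ≡ L
  split = m∸n+n≡m c≤L
  wrap : ∀ j → L ∸ c + j + c ≡ L + j
  wrap j = trans (+-assoc (L ∸ c) j c) (trans (cong (L ∸ c +_) (+-comm j c))
                 (trans (sym (+-assoc (L ∸ c) c j)) (cong (_+ j) split)))

-- A labeling of m vertices by elements of xs is a member of
-- allVecsOf xs m; an event constraining each coordinate separately is allV P, and it is
-- counted by the product of the coordinate counts.

ΣFin : ∀ m → (Fin m → ℕ) → ℕ
ΣFin m f = Σl (allFin m) f

ΣFin-suc : ∀ m (f : Fin (suc m) → ℕ) → ΣFin (suc m) f ≡ f zero + ΣFin m (f ∘ suc)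
ΣFin-suc m f =
  cong (f zero +_) (trans (cong (λ l → Σl l f) (sym (map-tabulate id suc))) (Σ-map suc (allFin m) f))

∏Fin : ∀ m → (Fin m → ℕ) → ℕ
∏Fin zero c = 1
∏Fin (suc m) c = c zero * ∏Fin m (c ∘ suc)

allV : {X : Set} {m : ℕ} → (Fin m → X → Bool) → Vec X m → Bool
allV P []ᵥ = true
allV P (u ∷ᵥ us) = P zero u ∧ allV (P ∘ suc) us

allV-sound : {X : Set} {m : ℕ} (P : Fin m → X → Bool) (us : Vec X m) → allV P us ≡ true →
  ∀ k → P k (lookup us k) ≡ true
allV-sound P (u ∷ᵥ us) e zero = ∧-true₁ e
allV-sound P (u ∷ᵥ us) e (suc k) = allV-sound (P ∘ suc) us (∧-true₂ (P zero u) e) k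

length-allVecsOf : {X : Set} (xs : List X) (m : ℕ) → length (allVecsOf xs m) ≡ length xs ^ m
length-allVecsOf xs zero = refl
length-allVecsOf xs (suc m) =
  trans (length-concatMap (λ u → map (u ∷ᵥ_) (allVecsOf xs m)) xs)
        (trans (Σ-cong xs (λ u → trans (length-map _ (allVecsOf xs m)) (length-allVecsOf xs m)))
               (Σ-const xs (length xs ^ m)))

ind-∧ : ∀ b c → ind (b ∧ c) ≡ ind b * ind c
ind-∧ true c = sym (+-identityʳ (ind c))
ind-∧ false c = refl

count-allV : {X : Set} (xs : List X) (m : ℕ) (P : Fin m → X → Bool) →
  Σl (allVecsOf xs m) (ind ∘ allV P) ≡ ∏Fin m (λ k → Σl xs (ind ∘ P k))
count-allV xs zero P = refl
count-allV xs (suc m) P =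
  begin
    Σl (concatMap (λ u → map (u ∷ᵥ_) (allVecsOf xs m)) xs) (ind ∘ allV P)
  ≡⟨ Σ-concatMap (λ u → map (u ∷ᵥ_) (allVecsOf xs m)) xs _ ⟩
    Σl xs (λ u → Σl (map (u ∷ᵥ_) (allVecsOf xs m)) (ind ∘ allV P))
  ≡⟨ Σ-cong xs first ⟩
    Σl xs (λ u → ind (P zero u) * R)
  ≡⟨ Σ-scaleʳ xs R (ind ∘ P zero) ⟩
    Σl xs (ind ∘ P zero) * R
  ∎
  where
  open ≡-Reasoning
  R = ∏Fin m (λ k → Σl xs (ind ∘ P (suc k)))
  first : ∀ u → Σl (map (u ∷ᵥ_) (allVecsOf xs m)) (ind ∘ allV P) ≡ ind (P zero u) * R
  first u =
    trans (Σ-map (u ∷ᵥ_) (allVecsOf xs m) _)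
    (trans (Σ-cong (allVecsOf xs m) (λ us → ind-∧ (P zero u) (allV (P ∘ suc) us)))
    (trans (Σ-scale (allVecsOf xs m) (ind (P zero u)) _) (cong (ind (P zero u) *_) (count-allV xs m (P ∘ suc)))))

∏Fin-scaling : ∀ m (M N : ℕ) (c δ g : Fin m → ℕ) → (∀ k → c k * M ^ δ k ≡ N * g k) →
  ∏Fin m c * M ^ ΣFin m δ ≡ N ^ m * ∏Fin m g
∏Fin-scaling zero M N c δ g h = refl
∏Fin-scaling (suc m) M N c δ g h =
  begin
    c zero * ∏Fin m (c ∘ suc) * M ^ ΣFin (suc m) δ
  ≡⟨ cong (λ e → c zero * ∏Fin m (c ∘ suc) * M ^ e) (ΣFin-suc m δ) ⟩
    c zero * ∏Fin m (c ∘ suc) * M ^ (δ zero + ΣFin m (δ ∘ suc))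
  ≡⟨ cong (c zero * ∏Fin m (c ∘ suc) *_) (^-distribˡ-+-* M (δ zero) _) ⟩
    c zero * ∏Fin m (c ∘ suc) * (M ^ δ zero * M ^ ΣFin m (δ ∘ suc))
  ≡⟨ interchange *-commutativeSemigroup (c zero) _ (M ^ δ zero) _ ⟩
    (c zero * M ^ δ zero) * (∏Fin m (c ∘ suc) * M ^ ΣFin m (δ ∘ suc))
  ≡⟨ cong₂ _*_ (h zero) (∏Fin-scaling m M N (c ∘ suc) (δ ∘ suc) (g ∘ suc) (h ∘ suc)) ⟩
    (N * g zero) * (N ^ m * ∏Fin m (g ∘ suc))
  ≡⟨ interchange *-commutativeSemigroup N (g zero) (N ^ m) _ ⟩
    (N * N ^ m) * (g zero * ∏Fin m (g ∘ suc))
  ∎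
  where open ≡-Reasoning

∏Fin-pow : ∀ m (M : ℕ) (e : Fin m → ℕ) → ∏Fin m (λ k → M ^ e k) ≡ M ^ ΣFin m e
∏Fin-pow zero M e = refl
∏Fin-pow (suc m) M e =
  trans (cong (M ^ e zero *_) (∏Fin-pow m M (e ∘ suc)))
        (trans (sym (^-distribˡ-+-* M (e zero) _)) (cong (M ^_) (sym (ΣFin-suc m e))))

-- With p₀/q₀ = 0.3652 < 1/e we show, for M = 2^r with r ≥ 2 and
-- s ≤ M - 1, that (1 - 1/M)^s ≥ p₀/q₀, in the fraction-free form p₀ · M^s ≤ q₀ · (M - 1)^s.
-- For M ≤ 64 this is a direct computation; for M ≥ 128 it follows from the monotonicity of
-- (1 - 1/M)^M and its value at M = 128.

p₀ q₀ : ℕ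
p₀ = 3652
q₀ = 10000

binomial-bound : ∀ a n → a ^ suc n + suc n * a ^ n ≤ suc a ^ suc n
binomial-bound a zero = ≤-reflexive (identity a)
  where
  identity : ∀ a → a * 1 + 1 * 1 ≡ (1 + a) * 1
  identity = solve-∀
binomial-bound a (suc n) =
  begin
    a ^ suc (suc n) + suc (suc n) * a ^ suc n
  ≡⟨ expand a (a ^ suc n) n ⟩
    a * a ^ suc n + suc n * a ^ suc n + a ^ suc n
  ≤⟨ +-monoʳ-≤ _ (m≤m+n (a ^ suc n) (suc n * a ^ n)) ⟩
    a * a ^ suc n + suc n * a ^ suc n + (a ^ suc n + suc n * a ^ n)
  ≡⟨ factor a (a ^ n) n ⟩
    suc a * (a ^ suc n + suc n * a ^ n)
  ≤⟨ *-monoʳ-≤ (suc a) (binomial-bound a n) ⟩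
    suc a ^ suc (suc n)
  ∎
  where
  open ≤-Reasoning
  expand : ∀ a x n → a * x + (2 + n) * x ≡ a * x + (1 + n) * x + x
  expand = solve-∀
  factor : ∀ a y n → a * (a * y) + (1 + n) * (a * y) + (a * y + (1 + n) * y) ≡ (1 + a) * (a * y + (1 + n) * y)
  factor = solve-∀

*-^-distrib : ∀ a b n → (a * b) ^ n ≡ a ^ n * b ^ n
*-^-distrib a b zero = refl
*-^-distrib a b (suc n) = trans (cong (a * b *_) (*-^-distrib a b n)) (interchange *-commutativeSemigroup a b _ _)

numer denom : ℕ → ℕ
numer M = (M ∸ 1) ^ M
denom M = M ^ M

-- (1 - 1/M)^M is increasing: numer(u+1)/denom(u+1) ≤ numer(u+2)/denom(u+2).
ratio-increasing : ∀ u → numer (suc u) * denom (2 + u) ≤ denom (suc u) * numer (2 + u)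
ratio-increasing u =
  begin
    u ^ suc u * (2 + u) ^ (2 + u)
  ≡⟨ regroup (u ^ suc u) ((2 + u) ^ suc u) (2 + u) ⟩
    u ^ suc u * (2 + u) ^ suc u * (2 + u)
  ≡⟨ cong (_* (2 + u)) (sym (*-^-distrib u (2 + u) (suc u))) ⟩
    w * w ^ u * (2 + u)
  ≤⟨ m≤m+n (w * w ^ u * (2 + u)) (w ^ u) ⟩
    w * w ^ u * (2 + u) + w ^ u
  ≡⟨ factor u (w ^ u) ⟩
    suc u * (w ^ suc u + suc u * w ^ u)
  ≤⟨ *-monoʳ-≤ (suc u) (binomial-bound w u) ⟩
    suc u * suc w ^ suc u
  ≡⟨ cong (λ z → suc u * z ^ suc u) (square u) ⟩
    suc u * (suc u * suc u) ^ suc u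
  ≡⟨ cong (suc u *_) (*-^-distrib (suc u) (suc u) (suc u)) ⟩
    suc u * (suc u ^ suc u * suc u ^ suc u)
  ≡⟨ x∙yz≈y∙xz *-commutativeSemigroup (suc u) (suc u ^ suc u) (suc u ^ suc u) ⟩
    suc u ^ suc u * suc u ^ (2 + u)
  ∎
  where
  open ≤-Reasoning
  w = u * (2 + u)
  regroup : ∀ x y z → x * (z * y) ≡ x * y * z
  regroup = solve-∀
  factor : ∀ u y → u * (2 + u) * y * (2 + u) + y ≡ (1 + u) * (u * (2 + u) * y + (1 + u) * y)
  factor = solve-∀
  square : ∀ u → 1 + u * (2 + u) ≡ (1 + u) * (1 + u)
  square = solve-∀

cross-trans : ∀ x₁ y₁ x₂ y₂ x₃ y₃ → 0 < y₂ →
  x₁ * y₂ ≤ y₁ * x₂ → x₂ * y₃ ≤ y₂ * x₃ → x₁ * y₃ ≤ y₁ * x₃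
cross-trans x₁ y₁ x₂ y₂@(suc _) x₃ y₃ _ h₁₂ h₂₃ = *-cancelʳ-≤ (x₁ * y₃) (y₁ * x₃) y₂
  (begin
    x₁ * y₃ * y₂   ≡⟨ xy∙z≈xz∙y *-commutativeSemigroup x₁ y₃ y₂ ⟩
    x₁ * y₂ * y₃   ≤⟨ *-monoˡ-≤ y₃ h₁₂ ⟩
    y₁ * x₂ * y₃   ≡⟨ *-assoc y₁ x₂ y₃ ⟩
    y₁ * (x₂ * y₃) ≤⟨ *-monoʳ-≤ y₁ h₂₃ ⟩
    y₁ * (y₂ * x₃) ≡⟨ x∙yz≈xz∙y *-commutativeSemigroup y₁ y₂ x₃ ⟩
    y₁ * x₃ * y₂   ∎)
  where open ≤-Reasoning

ratio-increasing* : ∀ u₀ r → numer (suc u₀) * denom (suc (r + u₀)) ≤ denom (suc u₀) * numer (suc (r + u₀))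
ratio-increasing* u₀ zero = ≤-reflexive (*-comm (numer (suc u₀)) _)
ratio-increasing* u₀ (suc r) =
  cross-trans (numer (suc u₀)) (denom (suc u₀)) (numer (suc (r + u₀))) (denom (suc (r + u₀)))
              (numer (2 + (r + u₀))) (denom (2 + (r + u₀)))
              (m^n>0 (suc (r + u₀)) (suc (r + u₀))) (ratio-increasing* u₀ r) (ratio-increasing (r + u₀))

large-base : ∀ u → 127 ≤ u → p₀ * suc u ^ u ≤ q₀ * u ^ u
large-base u 127≤u = *-cancelʳ-≤ (p₀ * suc u ^ u) (q₀ * u ^ u) (suc u)
  (begin
    p₀ * suc u ^ u * suc u    ≡⟨ *-assoc p₀ (suc u ^ u) (suc u) ⟩
    p₀ * (suc u ^ u * suc u)  ≡⟨ cong (p₀ *_) (*-comm (suc u ^ u) (suc u)) ⟩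
    p₀ * denom (suc u)        ≤⟨ via128 ⟩
    q₀ * numer (suc u)        ≡⟨ cong (q₀ *_) (*-comm u (u ^ u)) ⟩
    q₀ * (u ^ u * u)          ≡⟨ sym (*-assoc q₀ (u ^ u) u) ⟩
    q₀ * u ^ u * u            ≤⟨ *-monoʳ-≤ (q₀ * u ^ u) (n≤1+n u) ⟩
    q₀ * u ^ u * suc u        ∎)
  where
  open ≤-Reasoning
  at128 : p₀ * denom 128 ≤ q₀ * numer 128
  at128 = ≤ᵇ⇒≤ (p₀ * denom 128) (q₀ * numer 128) tt
  from128 : numer 128 * denom (suc u) ≤ denom 128 * numer (suc u)
  from128 = subst (λ z → numer 128 * denom (suc z) ≤ denom 128 * numer (suc z))
                  (m∸n+n≡m 127≤u) (ratio-increasing* 127 (u ∸ 127))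
  via128 : p₀ * denom (suc u) ≤ q₀ * numer (suc u)
  via128 = cross-trans p₀ q₀ (numer 128) (denom 128) (numer (suc u)) (denom (suc u))
                       (≤ᵇ⇒≤ 1 (denom 128) tt) at128 from128

lower-exponent : ∀ u s → s ≤ u → p₀ * suc u ^ u ≤ q₀ * u ^ u → p₀ * suc u ^ s ≤ q₀ * u ^ s
lower-exponent u s s≤u h = *-cancelʳ-≤ (p₀ * suc u ^ s) (q₀ * u ^ s) (suc u ^ D) {{m^n≢0 (suc u) D}}
  (begin
    p₀ * suc u ^ s * suc u ^ D   ≡⟨ *-assoc p₀ (suc u ^ s) (suc u ^ D) ⟩
    p₀ * (suc u ^ s * suc u ^ D) ≡⟨ cong (p₀ *_) (sym (^-distribˡ-+-* (suc u) s D)) ⟩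
    p₀ * suc u ^ (s + D)         ≡⟨ cong (λ e → p₀ * suc u ^ e) s+D≡u ⟩
    p₀ * suc u ^ u               ≤⟨ h ⟩
    q₀ * u ^ u                   ≡⟨ cong (λ e → q₀ * u ^ e) (sym s+D≡u) ⟩
    q₀ * u ^ (s + D)             ≡⟨ trans (cong (q₀ *_) (^-distribˡ-+-* u s D)) (sym (*-assoc q₀ (u ^ s) (u ^ D))) ⟩
    q₀ * u ^ s * u ^ D           ≤⟨ *-monoʳ-≤ (q₀ * u ^ s) (^-monoˡ-≤ D (n≤1+n u)) ⟩
    q₀ * u ^ s * suc u ^ D       ∎)
  where
  open ≤-Reasoning
  D = u ∸ s
  s+D≡u : s + D ≡ u
  s+D≡u = m+[n∸m]≡n s≤u

2^r≡1+[2^r∸1] : ∀ r → 2 ^ r ≡ suc (2 ^ r ∸ 1)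
2^r≡1+[2^r∸1] r = sym (trans (+-comm 1 _) (m∸n+n≡m {2 ^ r} {1} (m^n>0 2 r)))

-- The estimate used for both sides of an edge: (1 - 2^-r)^s ≥ p₀/q₀ for r ≥ 2, s < 2^r.
power-of-two-bound : ∀ r s → 2 ≤ r → s ≤ 2 ^ r ∸ 1 → p₀ * (2 ^ r) ^ s ≤ q₀ * (2 ^ r ∸ 1) ^ s
power-of-two-bound 1 s (s≤s ()) s≤
power-of-two-bound 2 s _ s≤ = lower-exponent 3 s s≤ (≤ᵇ⇒≤ _ _ tt)
power-of-two-bound 3 s _ s≤ = lower-exponent 7 s s≤ (≤ᵇ⇒≤ _ _ tt)
power-of-two-bound 4 s _ s≤ = lower-exponent 15 s s≤ (≤ᵇ⇒≤ _ _ tt)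
power-of-two-bound 5 s _ s≤ = lower-exponent 31 s s≤ (≤ᵇ⇒≤ _ _ tt)
power-of-two-bound 6 s _ s≤ = lower-exponent 63 s s≤ (≤ᵇ⇒≤ _ _ tt)
power-of-two-bound r@(suc (suc (suc (suc (suc (suc (suc r′))))))) s _ s≤ =
  subst (λ M → p₀ * M ^ s ≤ q₀ * u ^ s) (sym (2^r≡1+[2^r∸1] r)) (lower-exponent u s s≤ (large-base u 127≤u))
  where
  u = 2 ^ r ∸ 1
  127≤u : 127 ≤ u
  127≤u = ≤-pred (subst (128 ≤_) (2^r≡1+[2^r∸1] r)
                   (subst (128 ≤_) (sym (^-distribˡ-+-* 2 7 r′)) (*-monoʳ-≤ 128 (m^n>0 2 r′))))

ΣFin-point : ∀ m (x : Fin m) → ΣFin m (λ k → ind (eqFin k x)) ≡ 1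
ΣFin-point (suc m) zero =
  trans (ΣFin-suc m (λ k → ind (eqFin k zero))) (cong suc (Σ-zero (allFin m) _ (λ _ → refl)))
ΣFin-point (suc m) (suc x) = trans (ΣFin-suc m (λ k → ind (eqFin k (suc x)))) (ΣFin-point m x)

-- Labels of m vertices are drawn from xs, |xs| = N, and the event
-- constrains each vertex k by Pk k: the distinguished vertex x has probability 1/M, each of at
-- most M - 1 rivals has probability 1 - 1/M, and all other vertices are unconstrained.  With
-- M = 2^r, r ≥ 2, the event then has probability at least (1/M)(p₀/q₀).
one-side-bound : {X : Set} (xs : List X) (m M N r : ℕ) (Pk : Fin m → X → Bool) (x : Fin m)
  (rival : Fin m → Bool) → M ≡ 2 ^ r → 2 ≤ r →
  (∀ k → eqFin k x ≡ true → Σl xs (ind ∘ Pk k) * M ≡ N) →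
  (∀ k → eqFin k x ≡ false → rival k ≡ true → Σl xs (ind ∘ Pk k) * M ≡ N * (M ∸ 1)) →
  (∀ k → eqFin k x ≡ false → rival k ≡ false → Σl xs (ind ∘ Pk k) ≡ N) →
  ΣFin m (λ k → ind (not (eqFin k x) ∧ rival k)) ≤ M ∸ 1 →
  N ^ m * p₀ ≤ Σl (allVecsOf xs m) (ind ∘ allV Pk) * M * q₀
one-side-bound xs m M N r Pk x rival refl 2≤r at-x at-rival elsewhere few-rivals =
  *-cancelʳ-≤ (N ^ m * p₀) (C * M * q₀) (M ^ s) {{m^n≢0 M s {{m^n≢0 2 r}}}}
  (begin
    N ^ m * p₀ * M ^ s          ≡⟨ *-assoc (N ^ m) p₀ (M ^ s) ⟩
    N ^ m * (p₀ * M ^ s)        ≤⟨ *-monoʳ-≤ (N ^ m) (power-of-two-bound r s 2≤r few-rivals) ⟩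
    N ^ m * (q₀ * (M ∸ 1) ^ s)  ≡⟨ x∙yz≈xz∙y *-commutativeSemigroup (N ^ m) q₀ ((M ∸ 1) ^ s) ⟩
    N ^ m * (M ∸ 1) ^ s * q₀    ≡⟨ cong (_* q₀) (sym exact-count) ⟩
    C * M ^ (1 + s) * q₀        ≡⟨ regroup C M (M ^ s) q₀ ⟩
    C * M * q₀ * M ^ s          ∎)
  where
  open ≤-Reasoning
  C = Σl (allVecsOf xs m) (ind ∘ allV Pk)
  isRival : Fin m → ℕ
  isRival k = ind (not (eqFin k x) ∧ rival k)
  s = ΣFin m isRival
  δ : Fin m → ℕ
  δ k = ind (eqFin k x) + isRival k
  regroup : ∀ c m t q → c * (m * t) * q ≡ c * m * q * t
  regroup = solve-∀
  per-vertex : ∀ k → Σl xs (ind ∘ Pk k) * M ^ δ k ≡ N * (M ∸ 1) ^ isRival k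
  per-vertex k with eqFin k x in e₁ | rival k in e₂
  ... | true | _ = trans (cong (Σl xs (ind ∘ Pk k) *_) (*-identityʳ M))
                         (trans (at-x k e₁) (sym (*-identityʳ N)))
  ... | false | true = trans (cong (Σl xs (ind ∘ Pk k) *_) (*-identityʳ M))
                             (trans (at-rival k e₁ e₂) (cong (N *_) (sym (*-identityʳ (M ∸ 1)))))
  ... | false | false = trans (*-identityʳ _) (trans (elsewhere k e₁ e₂) (sym (*-identityʳ N)))
  exact-count : C * M ^ (1 + s) ≡ N ^ m * (M ∸ 1) ^ s
  exact-count =
    begin-equality
      C * M ^ (1 + s)
    ≡⟨ cong (λ e → C * M ^ e) (sym (trans (Σ-add (allFin m) (λ k → ind (eqFin k x)) isRival)
                                          (cong (_+ s) (ΣFin-point m x)))) ⟩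
      C * M ^ ΣFin m δ
    ≡⟨ cong (_* M ^ ΣFin m δ) (count-allV xs m Pk) ⟩
      ∏Fin m (λ k → Σl xs (ind ∘ Pk k)) * M ^ ΣFin m δ
    ≡⟨ ∏Fin-scaling m M N (λ k → Σl xs (ind ∘ Pk k)) δ (λ k → (M ∸ 1) ^ isRival k) per-vertex ⟩
      N ^ m * ∏Fin m (λ k → (M ∸ 1) ^ isRival k)
    ≡⟨ cong (N ^ m *_) (∏Fin-pow m (M ∸ 1) isRival) ⟩
      N ^ m * (M ∸ 1) ^ s
    ∎

eqEdge-sound : ∀ {m n} (e e' : Edge m n) → eqEdge e e' ≡ true → e ≡ e'
eqEdge-sound (x , y) (x' , y') h = cong₂ _,_ (eqFin-sound x x' (∧-true₁ h)) (eqFin-sound y y' (∧-true₂ (eqFin x x') h))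

eqEdge-refl : ∀ {m n} (e : Edge m n) → eqEdge e e ≡ true
eqEdge-refl (x , y) = ∧-intro (eqFin-refl x) (eqFin-refl y)

bool-clash : ∀ {b} → b ≡ false → b ≡ true → ⊥
bool-clash refl ()

eqFin-false⇒≢ : ∀ {k} (a b : Fin k) → eqFin a b ≡ false → a ≢ b
eqFin-false⇒≢ a .a e refl = bool-clash e (eqFin-refl a)

≢⇒eqFin-false : ∀ {k} (a b : Fin k) → a ≢ b → eqFin a b ≡ false
≢⇒eqFin-false a b a≢b with eqFin a b in e
... | true = ⊥-elim (a≢b (eqFin-sound a b e))
... | false = refl

adjacent-cases : ∀ {m n} (x x' : Fin m) (y y' : Fin n) → adjacentB (x , y) (x' , y') ≡ true →
  (x ≡ x' × y' ≢ y) ⊎ (y ≡ y' × x' ≢ x)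
adjacent-cases x x' y y' adj with eqFin x x' in ex | eqFin y y' in ey
adjacent-cases x x' y y' () | true | true
... | true | false = inj₁ (eqFin-sound x x' ex , λ { refl → eqFin-false⇒≢ y y ey refl })
... | false | true = inj₂ (eqFin-sound y y' ey , λ { refl → eqFin-false⇒≢ x x ex refl })

any-false : {A : Set} (f : A → Bool) (xs : List A) → (∀ x → x ∈ xs → f x ≡ false) → any f xs ≡ false
any-false f [] h = refl
any-false f (x ∷ xs) h rewrite h x (here refl) = any-false f xs (λ y p → h y (there p))

if-true : ∀ {A : Set} {c} {p q : A} → c ≡ true → (if c then p else q) ≡ p
if-true refl = refl

if-false : ∀ {A : Set} {c} {p q : A} → c ≡ false → (if c then p else q) ≡ q
if-false refl = refl

not-true : ∀ {b} → not b ≡ true → b ≡ false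
not-true {false} _ = refl

complement-scaling : ∀ c₁ c₂ M N → c₁ + c₂ ≡ N → c₂ * M ≡ N → c₁ * M ≡ N * (M ∸ 1)
complement-scaling c₁ c₂ M N sum≡ scaled =
  begin
    c₁ * M                 ≡⟨ sym (m+n∸n≡m (c₁ * M) N) ⟩
    c₁ * M + N ∸ N         ≡⟨ cong (λ t → c₁ * M + t ∸ N) (sym scaled) ⟩
    c₁ * M + c₂ * M ∸ N    ≡⟨ cong (_∸ N) (sym (*-distribʳ-+ M c₁ c₂)) ⟩
    (c₁ + c₂) * M ∸ N      ≡⟨ cong₂ (λ t u → t * M ∸ u) sum≡ (sym (*-identityʳ N)) ⟩
    N * M ∸ N * 1          ≡⟨ sym (*-distribˡ-∸ N M 1) ⟩
    N * (M ∸ 1)            ∎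
  where open ≡-Reasoning

module EdgeAnalysis (v : Variant) (k d m n : ℕ) (χ : Edge m n → Fin d) (E : List (Edge m n))
                    (proper : ProperColoring E χ) where
  open Hstructure v k

  inE : Edge m n → Bool
  inE e = any (eqEdge e) E

  inE-sound : ∀ e → inE e ≡ true → e ∈ E
  inE-sound e h with find (any⁻ (eqEdge e) E (subst IsTrue (sym h) tt))
  ... | e' , e'∈ , t = subst (_∈ E) (sym (eqEdge-sound e e' (Equivalence.to T-≡ t))) e'∈

  inE-complete : ∀ e → e ∈ E → inE e ≡ true
  inE-complete e e∈ = Equivalence.to T-≡ (any⁺ (eqEdge e) (lose e∈ (Equivalence.from T-≡ (eqEdge-refl e))))

  module Start (j : ℕ) where

    F : Edge m n → Maybe (Triple T)
    F e = Fval v T j (χ e)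

    F-mem : ∀ e {τ} → F e ≡ just τ →
      typ τ ∈ types v T × bitAt (cls τ) (typ τ) ≡ false × idx τ ∈ between 1 (2 ^ typ τ)
    F-mem e Fe = H-mem (nth-∈ H _ Fe)

    -- Since χ is proper and H is duplicate-free, F is injective on adjacent edges.
    F-injective : ∀ e₁ e₂ {τ} → e₁ ∈ E → e₂ ∈ E → (proj₁ e₁ ≡ proj₁ e₂ ⊎ proj₂ e₁ ≡ proj₂ e₂) →
      F e₁ ≡ just τ → F e₂ ≡ just τ → e₁ ≡ e₂
    F-injective e₁ e₂ e₁∈ e₂∈ share F₁ F₂ with eqEdge e₁ e₂ in same
    ... | true = eqEdge-sound e₁ e₂ same
    ... | false = ⊥-elim (proper e₁ e₂ e₁∈ e₂∈ distinct share sameColour)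
      where
      sameColour : χ e₁ ≡ χ e₂
      sameColour = toℕ-injective (+-cancelˡ-≡ j _ _ (nth-injective H H-unique _ _ F₁ F₂))
      distinct : e₁ ≢ e₂
      distinct refl = bool-clash same (eqEdge-refl e₁)

    eligible-just : ∀ la lb {x y c i z} → F (x , y) ≡ just (c , i , z) →
      Outcome.eligible v T d m n χ j la lb (x , y) ≡ eqBits c (lookup lb y) ∧ above c i (lookup la x)
    eligible-just la lb Fe rewrite Fe = refl

    eligible-nothing : ∀ la lb {x y} → F (x , y) ≡ nothing → Outcome.eligible v T d m n χ j la lb (x , y) ≡ false
    eligible-nothing la lb Fe rewrite Fe = refl

    typeOf-just : ∀ la lb {x y c i z} → F (x , y) ≡ just (c , i , z) → Outcome.typeOf v T d m n χ j la lb (x , y) ≡ i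
    typeOf-just la lb Fe rewrite Fe = refl

    module Event (x : Fin m) (y : Fin n) (a : Vec Bool T) (i z : ℕ)
                 (Fe₀ : F (x , y) ≡ just (a , i , z)) (e₀∈E : (x , y) ∈ E) where

      i-bounds : 2 ≤ i × i ≤ T
      i-bounds = types-mem v T (proj₁ (F-mem (x , y) Fe₀))

      a-bit : bitAt a i ≡ false
      a-bit = proj₁ (proj₂ (F-mem (x , y) Fe₀))

      -- x' is a rival of x if its edge to y has the same class a and type i: if a_x' lay above
      -- a at position i, that edge would be eligible too.
      sameCell : Maybe (Triple T) → Bool
      sameCell nothing = false
      sameCell (just (c , i' , _)) = eqBits a c ∧ (i' ≡ᵇ i)

      rivalX : Fin m → Bool
      rivalX x' = inE (x' , y) ∧ sameCell (F (x' , y))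

      -- y' is a rival of y (when a_x = b) if its edge to x has type i and a class c with b
      -- above c at position i: if a_y' = c, that edge would be eligible too.
      blocks : Vec Bool T → Maybe (Triple T) → Bool
      blocks b nothing = false
      blocks b (just (c , i' , _)) = (i' ≡ᵇ i) ∧ above c i b

      rivalY : Vec Bool T → Fin n → Bool
      rivalY b y' = inE (x , y') ∧ blocks b (F (x , y'))

      classOf : Maybe (Triple T) → Vec Bool T
      classOf nothing = a
      classOf (just (c , _ , _)) = c

      -- The event, one condition per vertex: a_x lies above a at position i while no rival x'
      -- does; a_y = a while no rival y' carries the class of its edge to x.
      PA : Fin m → Vec Bool T → Bool
      PA x' u = if eqFin x' x then above a i u else (if rivalX x' then not (above a i u) else true)

      PB : Vec Bool T → Fin n → Vec Bool T → Bool
      PB b y' u = if eqFin y' y then eqBits a u else (if rivalY b y' then not (eqBits (classOf (F (x , y'))) u) else true)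

      PA-at-x : ∀ la → allV PA la ≡ true → above a i (lookup la x) ≡ true
      PA-at-x la h = trans (sym (if-true (eqFin-refl x))) (allV-sound PA la h x)

      PA-at-rival : ∀ la x' → allV PA la ≡ true → x' ≢ x → rivalX x' ≡ true → above a i (lookup la x') ≡ false
      PA-at-rival la x' h x'≢x r =
        not-true (trans (sym (trans (if-false (≢⇒eqFin-false x' x x'≢x)) (if-true r))) (allV-sound PA la h x'))

      PB-at-y : ∀ b lb → allV (PB b) lb ≡ true → eqBits a (lookup lb y) ≡ true
      PB-at-y b lb h = trans (sym (if-true (eqFin-refl y))) (allV-sound (PB b) lb h y)

      PB-at-rival : ∀ b lb y' → allV (PB b) lb ≡ true → y' ≢ y → rivalY b y' ≡ true →
        eqBits (classOf (F (x , y'))) (lookup lb y') ≡ false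
      PB-at-rival b lb y' h y'≢y r =
        not-true (trans (sym (trans (if-false (≢⇒eqFin-false y' y y'≢y)) (if-true r))) (allV-sound (PB b) lb h y'))

      -- An eligible edge (x' , y) of type i, x' ≠ x, has class a_y = a, so x' is a rival.
      rival-x-excluded : ∀ la lb x' c z' → allV PA la ≡ true → allV (PB (lookup la x)) lb ≡ true →
        (x' , y) ∈ E → x' ≢ x → F (x' , y) ≡ just (c , i , z') →
        eqBits c (lookup lb y) ≡ true → above c i (lookup la x') ≡ true → ⊥
      rival-x-excluded la lb x' c z' hA hB e∈ x'≢x Fe c-at-y c-above =
        bool-clash (PA-at-rival la x' hA x'≢x rival) (subst (λ w → above w i (lookup la x') ≡ true) c≡a c-above)
        where
        c≡a : c ≡ a
        c≡a = trans (eqBits-sound c (lookup lb y) c-at-y) (sym (eqBits-sound a (lookup lb y) (PB-at-y _ lb hB)))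
        rival : rivalX x' ≡ true
        rival = ∧-intro (inE-complete _ e∈)
                  (trans (cong sameCell Fe)
                         (∧-intro (subst (λ w → eqBits a w ≡ true) (sym c≡a) (eqBits-refl a)) (≡ᵇ-refl i)))

      rival-y-excluded : ∀ la lb y' c z' → allV (PB (lookup la x)) lb ≡ true →
        (x , y') ∈ E → y' ≢ y → F (x , y') ≡ just (c , i , z') →
        eqBits c (lookup lb y') ≡ true → above c i (lookup la x) ≡ true → ⊥
      rival-y-excluded la lb y' c z' hB e∈ y'≢y Fe c-at-y' c-above =
        bool-clash (subst (λ w → eqBits (classOf w) (lookup lb y') ≡ false) Fe (PB-at-rival _ lb y' hB y'≢y rival)) c-at-y'
        where
        rival : rivalY (lookup la x) y' ≡ true
        rival = ∧-intro (inE-complete _ e∈) (trans (cong (blocks (lookup la x)) Fe) (∧-intro (≡ᵇ-refl i) c-above))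

      event⇒kept : ∀ la lb → allV PA la ≡ true → allV (PB (lookup la x)) lb ≡ true →
        Outcome.kept v T d m n χ j la lb E (x , y) ≡ true
      event⇒kept la lb hA hB = ∧-intro eligible₀ (cong not (any-false _ E no-conflict))
        where
        open Outcome v T d m n χ j la lb
        eligible₀ : eligible (x , y) ≡ true
        eligible₀ = trans (eligible-just la lb Fe₀) (∧-intro (PB-at-y _ lb hB) (PA-at-x la hA))
        conflict : ∀ x' y' → (x' , y') ∈ E → (mτ : Maybe (Triple T)) → F (x' , y') ≡ mτ →
          (eligible (x' , y') ∧ adjacentB (x , y) (x' , y') ∧ (typeOf (x , y) ≡ᵇ typeOf (x' , y'))) ≡ true → ⊥
        conflict x' y' e∈ nothing Fe h = bool-clash (eligible-nothing la lb Fe) (∧-true₁ h)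
        conflict x' y' e∈ (just (c , i' , z')) Fe h
          with trans (sym (typeOf-just la lb Fe₀)) (trans (≡ᵇ-sound _ _ same-type) (typeOf-just la lb Fe))
             | adjacent-cases x x' y y' (∧-true₁ rest)
          where
          rest = ∧-true₂ (eligible (x' , y')) h
          same-type = ∧-true₂ (adjacentB (x , y) (x' , y')) rest
        ... | refl | inj₁ (refl , y'≢y) =
          rival-y-excluded la lb y' c z' hB e∈ y'≢y Fe (∧-true₁ elig) (∧-true₂ (eqBits c (lookup lb y')) elig)
          where elig = trans (sym (eligible-just la lb Fe)) (∧-true₁ h)
        ... | refl | inj₂ (refl , x'≢x) =
          rival-x-excluded la lb x' c z' hA hB e∈ x'≢x Fe (∧-true₁ elig) (∧-true₂ (eqBits c (lookup lb y)) elig)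
          where elig = trans (sym (eligible-just la lb Fe)) (∧-true₁ h)
        no-conflict : ∀ e' → e' ∈ E → (eligible e' ∧ adjacentB (x , y) e' ∧ (typeOf (x , y) ≡ᵇ typeOf e')) ≡ false
        no-conflict (x' , y') e∈
          with eligible (x' , y') ∧ adjacentB (x , y) (x' , y') ∧ (typeOf (x , y) ≡ᵇ typeOf (x' , y')) in h
        ... | false = refl
        ... | true = ⊥-elim (conflict x' y' e∈ (F (x' , y')) refl h)

      -- The rivals of x: their edges to y are pairwise distinct elements (a , i , z') of H with
      -- z' ≠ z, so there are at most 2^i - 1 of them.
      sameCell-spec : ∀ mτ → sameCell mτ ≡ true → ∃ λ z' → mτ ≡ just (a , i , z')
      sameCell-spec (just (c , i' , z')) h
        with eqBits-sound a c (∧-true₁ h) | ≡ᵇ-sound i' i (∧-true₂ (eqBits a c) h)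
      ... | refl | refl = z' , refl

      rivalX-spec : ∀ x' → rivalX x' ≡ true → (x' , y) ∈ E × ∃ λ z' → F (x' , y) ≡ just (a , i , z')
      rivalX-spec x' r = inE-sound _ (∧-true₁ r) , sameCell-spec (F (x' , y)) (∧-true₂ (inE (x' , y)) r)

      few-rivalsX : ΣFin m (λ x' → ind (not (eqFin x' x) ∧ rivalX x')) ≤ 2 ^ i ∸ 1
      few-rivalsX = <⇒≤∸1 (subst (ΣFin m (ind ∘ selected) <_)
                                 (trans (length-map _ (between 1 (2 ^ i))) (length-between1 (2 ^ i)))
        (count-by-injection (allFin m) (allFin⁺ m) selected (λ x' → F (x' , y)) cellAI (just (a , i , z))
                            injective into (∈-map⁺ _ (proj₂ (proj₂ (F-mem (x , y) Fe₀)))) avoids))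
        where
        selected : Fin m → Bool
        selected x' = not (eqFin x' x) ∧ rivalX x'
        cellAI = map (λ z' → just (a , i , z')) (between 1 (2 ^ i))
        spec : ∀ x' → selected x' ≡ true → (x' , y) ∈ E × ∃ λ z' → F (x' , y) ≡ just (a , i , z')
        spec x' s = rivalX-spec x' (∧-true₂ (not (eqFin x' x)) s)
        injective : ∀ x₁ x₂ → selected x₁ ≡ true → selected x₂ ≡ true →
          F (x₁ , y) ≡ F (x₂ , y) → x₁ ≡ x₂
        injective x₁ x₂ s₁ s₂ same with spec x₁ s₁ | spec x₂ s₂
        ... | e₁∈ , _ , F₁ | e₂∈ , _ , _ =
          cong proj₁ (F-injective (x₁ , y) (x₂ , y) e₁∈ e₂∈ (inj₂ refl) F₁ (trans (sym same) F₁))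
        into : ∀ x' → selected x' ≡ true → F (x' , y) ∈ cellAI
        into x' s with spec x' s
        ... | _ , z' , Fe rewrite Fe = ∈-map⁺ _ (proj₂ (proj₂ (F-mem (x' , y) Fe)))
        avoids : ∀ x' → selected x' ≡ true → F (x' , y) ≢ just (a , i , z)
        avoids x' s same with spec x' s
        ... | e∈ , _ = bool-clash (cong not (eqFin-refl x))
                         (subst (λ w → not (eqFin w x) ≡ true)
                                (cong proj₁ (F-injective (x' , y) (x , y) e∈ e₀∈E (inj₂ refl) same Fe₀))
                                (∧-true₁ s))

      -- The rivals of y, when a_x = b lies above a at i: their edges to x are pairwise distinct
      -- elements (c , i , z') of H with b above c at i, other than (a , i , z).  There are at
      -- most 2^(t-i) such classes c, so at most 2^t - 1 rivals.
      blocks-spec : ∀ b mτ → blocks b mτ ≡ true →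
        ∃ λ c → ∃ λ z' → mτ ≡ just (c , i , z') × above c i b ≡ true
      blocks-spec b (just (c , i' , z')) h with ≡ᵇ-sound i' i (∧-true₁ h)
      ... | refl = c , z' , refl , ∧-true₂ (i ≡ᵇ i) h

      rivalY-spec : ∀ b y' → rivalY b y' ≡ true →
        (x , y') ∈ E × ∃ λ c → ∃ λ z' → F (x , y') ≡ just (c , i , z') × above c i b ≡ true
      rivalY-spec b y' r = inE-sound _ (∧-true₁ r) , blocks-spec b (F (x , y')) (∧-true₂ (inE (x , y')) r)

      -- The possible F-values of edges of type i whose class lies below b at position i: at
      -- most 2^(t-i) classes times 2^i indices.
      cellsBelow : Vec Bool T → List (Maybe (Triple T))
      cellsBelow b = concatMap cellOf (filter (λ c → above c i b Data.Bool.≟ true) (allBits T))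
        where
        cellOf : Vec Bool T → List (Maybe (Triple T))
        cellOf c = map (λ z' → just (c , i , z')) (between 1 (2 ^ i))

      ∈-cellsBelow : ∀ b c z' → above c i b ≡ true → z' ∈ between 1 (2 ^ i) → just (c , i , z') ∈ cellsBelow b
      ∈-cellsBelow b c z' c-below z'∈ =
        ∈-concatMap-intro _ (∈-filter⁺ (λ c → above c i b Data.Bool.≟ true) (∈-allBits c) c-below) (∈-map⁺ _ z'∈)

      length-cellsBelow : ∀ b → length (cellsBelow b) ≤ 2 ^ T
      length-cellsBelow b =
        subst (_≤ 2 ^ T) (sym count) (count-below T i b (≤-trans (s≤s z≤n) (proj₁ i-bounds)) (proj₂ i-bounds))
        where
        classesBelow = filter (λ c → above c i b Data.Bool.≟ true) (allBits T)
        count : length (cellsBelow b) ≡ Σl (allBits T) (λ c → ind (above c i b)) * 2 ^ i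
        count =
          trans (length-concatMap _ classesBelow)
          (trans (Σ-cong classesBelow (λ c → trans (length-map _ (between 1 (2 ^ i))) (length-between1 (2 ^ i))))
          (trans (Σ-const classesBelow (2 ^ i)) (cong (_* 2 ^ i) (length-filter (λ c → above c i b) (allBits T)))))

      few-rivalsY : ∀ b → above a i b ≡ true → ΣFin n (λ y' → ind (not (eqFin y' y) ∧ rivalY b y')) ≤ 2 ^ T ∸ 1
      few-rivalsY b a-below-b = <⇒≤∸1 (≤-trans
        (count-by-injection (allFin n) (allFin⁺ n) selected (λ y' → F (x , y')) (cellsBelow b) (just (a , i , z))
           injective into (∈-cellsBelow b a z a-below-b (proj₂ (proj₂ (F-mem (x , y) Fe₀)))) avoids)
        (length-cellsBelow b))
        where
        selected : Fin n → Bool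
        selected y' = not (eqFin y' y) ∧ rivalY b y'
        spec : ∀ y' → selected y' ≡ true →
          (x , y') ∈ E × ∃ λ c → ∃ λ z' → F (x , y') ≡ just (c , i , z') × above c i b ≡ true
        spec y' s = rivalY-spec b y' (∧-true₂ (not (eqFin y' y)) s)
        injective : ∀ y₁ y₂ → selected y₁ ≡ true → selected y₂ ≡ true →
          F (x , y₁) ≡ F (x , y₂) → y₁ ≡ y₂
        injective y₁ y₂ s₁ s₂ same with spec y₁ s₁ | spec y₂ s₂
        ... | e₁∈ , _ , _ , F₁ , _ | e₂∈ , _ =
          cong proj₂ (F-injective (x , y₁) (x , y₂) e₁∈ e₂∈ (inj₁ refl) F₁ (trans (sym same) F₁))
        into : ∀ y' → selected y' ≡ true → F (x , y') ∈ cellsBelow b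
        into y' s with spec y' s
        ... | _ , c , z' , Fe , c-below rewrite Fe = ∈-cellsBelow b c z' c-below (proj₂ (proj₂ (F-mem (x , y') Fe)))
        avoids : ∀ y' → selected y' ≡ true → F (x , y') ≢ just (a , i , z)
        avoids y' s same with spec y' s
        ... | e∈ , _ = bool-clash (cong not (eqFin-refl y))
                         (subst (λ w → not (eqFin w y) ≡ true)
                                (cong proj₂ (F-injective (x , y') (x , y) e∈ e₀∈E (inj₁ refl) same Fe₀))
                                (∧-true₁ s))

      N : ℕ
      N = 2 ^ T

      labelsA = allVecsOf (allBits T) m
      labelsB = allVecsOf (allBits T) n

      -- A-side: Pr[event on A] ≥ 2^-i · p₀/q₀ (a_x above a at i: probability 2^-i; each rival
      -- not above: probability 1 - 2^-i).
      countA : ℕ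
      countA = Σl labelsA (ind ∘ allV PA)

      A-side : N ^ m * p₀ ≤ countA * 2 ^ i * q₀
      A-side = one-side-bound (allBits T) m (2 ^ i) N i PA x rivalX refl (proj₁ i-bounds)
                 at-x at-rival elsewhere few-rivalsX
        where
        exactly-above : Σl (allBits T) (λ u → ind (above a i u)) * 2 ^ i ≡ N
        exactly-above = count-above T i a (≤-trans (s≤s z≤n) (proj₁ i-bounds)) (proj₂ i-bounds) a-bit
        at-x : ∀ k → eqFin k x ≡ true → Σl (allBits T) (ind ∘ PA k) * 2 ^ i ≡ N
        at-x k e = trans (cong (_* 2 ^ i) (Σ-cong (allBits T) (λ u → cong ind (if-true e)))) exactly-above
        at-rival : ∀ k → eqFin k x ≡ false → rivalX k ≡ true → Σl (allBits T) (ind ∘ PA k) * 2 ^ i ≡ N * (2 ^ i ∸ 1)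
        at-rival k e r =
          trans (cong (_* 2 ^ i) (Σ-cong (allBits T) (λ u → cong ind (trans (if-false e) (if-true r)))))
                (complement-scaling (Σl (allBits T) (λ u → ind (not (above a i u)))) _ (2 ^ i) N
                   (trans (Σ-ind-not (allBits T) (above a i)) (length-allBits T)) exactly-above)
        elsewhere : ∀ k → eqFin k x ≡ false → rivalX k ≡ false → Σl (allBits T) (ind ∘ PA k) ≡ N
        elsewhere k e r = trans (Σ-cong (allBits T) (λ u → cong ind (trans (if-false e) (if-false r)))) (Σ-allBits-one T)

      -- B-side, given a_x = b above a at i: Pr[event on B] ≥ 2^-t · p₀/q₀ (a_y = a: probability
      -- 2^-t; each rival avoiding one class: probability 1 - 2^-t).
      countB : Vec Bool T → ℕ
      countB b = Σl labelsB (ind ∘ allV (PB b))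

      B-side : ∀ b → above a i b ≡ true → N ^ n * p₀ ≤ countB b * N * q₀
      B-side b a-below-b = one-side-bound (allBits T) n N N T (PB b) y (rivalY b) refl (s≤s (s≤s z≤n))
                             at-y at-rival elsewhere (few-rivalsY b a-below-b)
        where
        at-y : ∀ k → eqFin k y ≡ true → Σl (allBits T) (ind ∘ PB b k) * N ≡ N
        at-y k e = trans (cong (_* N) (trans (Σ-cong (allBits T) (λ u → cong ind (if-true e))) (count-equal T a)))
                         (+-identityʳ N)
        at-rival : ∀ k → eqFin k y ≡ false → rivalY b k ≡ true → Σl (allBits T) (ind ∘ PB b k) * N ≡ N * (N ∸ 1)
        at-rival k e r =
          trans (cong (_* N) (Σ-cong (allBits T) (λ u → cong ind (trans (if-false e) (if-true r)))))
                (complement-scaling notC 1 N N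
                   (trans (cong (notC +_) (sym (count-equal T c))) (trans (Σ-ind-not (allBits T) (eqBits c)) (length-allBits T)))
                   (+-identityʳ N))
          where
          c = classOf (F (x , k))
          notC = Σl (allBits T) (λ u → ind (not (eqBits c u)))
        elsewhere : ∀ k → eqFin k y ≡ false → rivalY b k ≡ false → Σl (allBits T) (ind ∘ PB b k) ≡ N
        elsewhere k e r = trans (Σ-cong (allBits T) (λ u → cong ind (trans (if-false e) (if-false r)))) (Σ-allBits-one T)

      keptCount : ℕ
      keptCount = Σl labelsA (λ la → Σl labelsB (λ lb → ind (Outcome.kept v T d m n χ j la lb E (x , y))))

      eventCount : ℕ
      eventCount = Σl labelsA (λ la → ind (allV PA la) * countB (lookup la x))

      event≤kept : eventCount ≤ keptCount
      event≤kept = Σ-mono labelsA (λ la _ →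
        subst (_≤ _) (Σ-scale labelsB (ind (allV PA la)) _) (Σ-mono labelsB (λ lb _ → pointwise la lb)))
        where
        pointwise : ∀ la lb → ind (allV PA la) * ind (allV (PB (lookup la x)) lb) ≤
                              ind (Outcome.kept v T d m n χ j la lb E (x , y))
        pointwise la lb with allV PA la in hA | allV (PB (lookup la x)) lb in hB
        ... | false | _ = z≤n
        ... | true | false = z≤n
        ... | true | true = ≤-reflexive (cong ind (sym (event⇒kept la lb hA hB)))

      B-side-on-event : countA * (N ^ n * p₀) ≤ eventCount * (N * q₀)
      B-side-on-event = subst₂ _≤_ (Σ-scaleʳ labelsA (N ^ n * p₀) (ind ∘ allV PA))
                                             (Σ-scaleʳ labelsA (N * q₀) (λ la → ind (allV PA la) * countB (lookup la x)))
                          (Σ-mono labelsA (λ la _ → pointwise la))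
        where
        pointwise : ∀ la → ind (allV PA la) * (N ^ n * p₀) ≤ ind (allV PA la) * countB (lookup la x) * (N * q₀)
        pointwise la with allV PA la in hA
        ... | false = z≤n
        ... | true = subst₂ _≤_ (sym (*-identityˡ _))
                       (trans (*-assoc (countB (lookup la x)) N q₀)
                              (sym (cong (_* (N * q₀)) (*-identityˡ (countB (lookup la x))))))
                       (B-side (lookup la x) (PA-at-x la hA))

      kept-bound : N ^ m * N ^ n * (p₀ * p₀) ≤ keptCount * (q₀ * q₀) * (N * 2 ^ i)
      kept-bound =
        begin
          N ^ m * N ^ n * (p₀ * p₀)
        ≡⟨ regroup₁ (N ^ m) (N ^ n) p₀ ⟩
          N ^ m * p₀ * (N ^ n * p₀)
        ≤⟨ *-monoˡ-≤ (N ^ n * p₀) A-side ⟩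
          countA * 2 ^ i * q₀ * (N ^ n * p₀)
        ≡⟨ regroup₂ countA (2 ^ i) q₀ (N ^ n * p₀) ⟩
          countA * (N ^ n * p₀) * (2 ^ i * q₀)
        ≤⟨ *-monoˡ-≤ (2 ^ i * q₀) B-side-on-event ⟩
          eventCount * (N * q₀) * (2 ^ i * q₀)
        ≤⟨ *-monoˡ-≤ (2 ^ i * q₀) (*-monoˡ-≤ (N * q₀) event≤kept) ⟩
          keptCount * (N * q₀) * (2 ^ i * q₀)
        ≡⟨ regroup₃ keptCount N q₀ (2 ^ i) ⟩
          keptCount * (q₀ * q₀) * (N * 2 ^ i)
        ∎
        where
        open ≤-Reasoning
        regroup₁ : ∀ a b p → a * b * (p * p) ≡ a * p * (b * p)
        regroup₁ = solve-∀
        regroup₂ : ∀ c t q r → c * t * q * r ≡ c * r * (t * q)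
        regroup₂ = solve-∀
        regroup₃ : ∀ κ ν q t → κ * (ν * q) * (t * q) ≡ κ * (q * q) * (ν * t)
        regroup₃ = solve-∀

module Starts (v : Variant) (k : ℕ) where
  open Hstructure v k

  -- The admissible starts are the positions of H₀, i.e. 0 … L-1.
  L : ℕ
  L = length H₀

  length-H : length H ≡ L + L
  length-H = trans (cong length H-split) (trans (length-++ H₀) (cong (L +_) length-H₁))

  nth-H₀ : ∀ p → p < L → nth H p ≡ nth H₀ p
  nth-H₀ p p<L = trans (cong (λ h → nth h p) H-split) (nth-++ˡ H₀ H₁ p p<L)

  nth-H₁ : ∀ p → nth H (L + p) ≡ nth H₁ p
  nth-H₁ p = trans (cong (λ h → nth h (L + p)) H-split) (nth-++ʳ H₀ H₁ p)

  Σ-starts : ∀ h → Σl (starts v T) h ≡ Σ< L h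
  Σ-starts h =
    begin
      Σl (starts v T) h
    ≡⟨ Σ-filter (startsAt H) (upTo (length H)) h ⟩
      Σ< (length H) (λ p → ind (startsAt H p) * h p)
    ≡⟨ cong (λ l → Σ< l (λ p → ind (startsAt H p) * h p)) length-H ⟩
      Σ< (L + L) (λ p → ind (startsAt H p) * h p)
    ≡⟨ Σ<-+ L L _ ⟩
      Σ< L (λ p → ind (startsAt H p) * h p) + Σ< L (λ p → ind (startsAt H (L + p)) * h (L + p))
    ≡⟨ cong₂ _+_ (Σ<-cong L in-H₀) (trans (Σ<-cong L in-H₁) (Σ-zero (upTo L) _ (λ _ → refl))) ⟩
      Σ< L h + 0
    ≡⟨ +-identityʳ _ ⟩
      Σ< L h
    ∎
    where
    open ≡-Reasoning
    startsAt-just : ∀ p τ → nth H p ≡ just τ → startsAt H p ≡ not (bitAt (cls τ) 1)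
    startsAt-just p τ e rewrite e = refl
    startsAt-nothing : ∀ p → nth H p ≡ nothing → startsAt H p ≡ false
    startsAt-nothing p e rewrite e = refl
    in-H₀ : ∀ p → p < L → ind (startsAt H p) * h p ≡ h p
    in-H₀ p p<L with nth-defined H₀ p p<L
    ... | τ , e = trans (cong (λ b → ind b * h p)
                          (trans (startsAt-just p τ (trans (nth-H₀ p p<L) e)) (cong not (H₀-firstBit (nth-∈ H₀ p e)))))
                        (+-identityʳ (h p))
    in-H₁ : ∀ p → p < L → ind (startsAt H (L + p)) * h (L + p) ≡ 0
    in-H₁ p _ with nth H₁ p in e
    ... | nothing = cong (λ b → ind b * h (L + p)) (startsAt-nothing (L + p) (trans (nth-H₁ p) e))
    ... | just τ = cong (λ b → ind b * h (L + p))
                        (trans (startsAt-just (L + p) τ (trans (nth-H₁ p) e)) (cong not (H₁-firstBit (nth-∈ H₁ p e))))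

  length-starts : length (starts v T) ≡ L
  length-starts = trans (sym (Σ-one (starts v T))) (trans (Σ-starts (λ _ → 1)) (trans (Σ-one (upTo L)) (length-upTo L)))

  L-value : L + 2 ^ k * 4 ≡ 2 ^ k * 2 ^ (3 + k)
  L-value =
    begin
      L + 2 ^ k * 4
    ≡⟨ cong (_+ 2 ^ k * 4) (trans (sym (Σ-one H₀)) (trans (Σ-H₀ (λ _ → 1)) (cong (2 ^ k *_) Σ-types-pow))) ⟩
      2 ^ k * Σ< (suc k) (λ u → 2 ^ (2 + u)) + 2 ^ k * 4
    ≡⟨ sym (*-distribˡ-+ (2 ^ k) _ 4) ⟩
      2 ^ k * (Σ< (suc k) (λ u → 2 ^ (2 + u)) + 4)
    ≡⟨ cong (2 ^ k *_) (geometric (suc k)) ⟩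
      2 ^ k * 2 ^ (3 + k)
    ∎
    where
    open ≡-Reasoning
    Σ-types-pow : Σl (types v T) (λ i → 2 ^ i * 1) ≡ Σ< (suc k) (λ u → 2 ^ (2 + u))
    Σ-types-pow = trans (Σ-types v T (λ i → 2 ^ i * 1)) (trans (Σ-map (2 +_) (upTo (suc k)) (λ i → 2 ^ i * 1))
                        (Σ-cong (upTo (suc k)) (λ u → *-identityʳ (2 ^ (2 + u)))))
    geometric : ∀ r → Σ< r (λ u → 2 ^ (2 + u)) + 4 ≡ 2 ^ (2 + r)
    geometric zero = refl
    geometric (suc r) =
      begin
        Σ< (suc r) f + 4
      ≡⟨ cong (λ l → Σl l f + 4) (sym (upTo-∷ʳ r)) ⟩
        Σl (upTo r ++ [ r ]) f + 4
      ≡⟨ cong (_+ 4) (Σ-++ (upTo r) [ r ] f) ⟩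
        Σ< r f + (f r + 0) + 4
      ≡⟨ shuffle (Σ< r f) (f r) ⟩
        (Σ< r f + 4) + f r
      ≡⟨ cong (_+ f r) (geometric r) ⟩
        f r + f r
      ≡⟨ cong (f r +_) (sym (+-identityʳ (f r))) ⟩
        2 ^ (2 + suc r)
      ∎
      where
      f : ℕ → ℕ
      f u = 2 ^ (2 + u)
      shuffle : ∀ s x → s + (x + 0) + 4 ≡ s + 4 + x
      shuffle = solve-∀

  L-lower : 2 ^ (2 * suc k) ≤ L
  L-lower = +-cancelʳ-≤ (2 ^ k * 4) _ _
    (begin
      2 ^ (2 * suc k) + 2 ^ k * 4        ≡⟨ cong (λ e → 2 ^ e + 2 ^ k * 4) (exponent k) ⟩
      2 ^ (k + (2 + k)) + 2 ^ k * 4      ≡⟨ cong (_+ 2 ^ k * 4) (^-distribˡ-+-* 2 k (2 + k)) ⟩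
      2 ^ k * 2 ^ (2 + k) + 2 ^ k * 4    ≡⟨ sym (*-distribˡ-+ (2 ^ k) (2 ^ (2 + k)) 4) ⟩
      2 ^ k * (2 ^ (2 + k) + 4)          ≤⟨ *-monoʳ-≤ (2 ^ k) (+-monoʳ-≤ (2 ^ (2 + k)) four≤) ⟩
      2 ^ k * (2 ^ (2 + k) + 2 ^ (2 + k)) ≡⟨ cong (λ w → 2 ^ k * (2 ^ (2 + k) + w)) (sym (+-identityʳ _)) ⟩
      2 ^ k * 2 ^ (3 + k)                ≡⟨ sym L-value ⟩
      L + 2 ^ k * 4                      ∎)
    where
    open ≤-Reasoning
    exponent : ∀ k → 2 * suc k ≡ k + (2 + k)
    exponent = solve-∀
    four≤ : 4 ≤ 2 ^ (2 + k)
    four≤ = subst (4 ≤_) (sym (^-distribˡ-+-* 2 2 k)) (*-monoʳ-≤ 4 (m^n>0 2 k))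

  L-upper : L ≤ 8 * 2 ^ (2 * k)
  L-upper =
    begin
      L                        ≤⟨ m≤m+n L (2 ^ k * 4) ⟩
      L + 2 ^ k * 4            ≡⟨ L-value ⟩
      2 ^ k * 2 ^ (3 + k)      ≡⟨ sym (^-distribˡ-+-* 2 k (3 + k)) ⟩
      2 ^ (k + (3 + k))        ≡⟨ cong (2 ^_) (exponent k) ⟩
      2 ^ (3 + 2 * k)          ≡⟨ ^-distribˡ-+-* 2 3 (2 * k) ⟩
      8 * 2 ^ (2 * k)          ∎
    where
    open ≤-Reasoning
    exponent : ∀ k → k + (3 + k) ≡ 3 + 2 * k
    exponent = solve-∀

  -- Along H, position p carries the weight 2^(t - i) of its type i.  This weight is
  -- L-periodic, since both halves of H have the same sequence of types.
  typeAt : ℕ → Maybe ℕ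
  typeAt p = Maybe.map typ (nth H p)

  weight : Maybe ℕ → ℕ
  weight nothing = 0
  weight (just i) = 2 ^ (T ∸ i)

  typeAt-periodic : ∀ p → p < L → typeAt (L + p) ≡ typeAt p
  typeAt-periodic p p<L =
    begin
      Maybe.map typ (nth H (L + p))   ≡⟨ cong (Maybe.map typ) (nth-H₁ p) ⟩
      Maybe.map typ (nth H₁ p)        ≡⟨ sym (nth-map typ H₁ p) ⟩
      nth (map typ H₁) p              ≡⟨ cong (λ l → nth l p) (sym types-H₀≡H₁) ⟩
      nth (map typ H₀) p              ≡⟨ nth-map typ H₀ p ⟩
      Maybe.map typ (nth H₀ p)        ≡⟨ cong (Maybe.map typ) (sym (nth-H₀ p p<L)) ⟩
      Maybe.map typ (nth H p)         ∎
    where open ≡-Reasoning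

  -- Σ_{p<L} 2^(t - type(p)) = 2^k (k+1) 2^t: each of the k+1 types i contributes 2^k · 2^i · 2^(t-i).
  Σ-weights : Σ< L (weight ∘ typeAt) ≡ 2 ^ k * (suc k * 2 ^ T)
  Σ-weights =
    begin
      Σ< L (weight ∘ typeAt)
    ≡⟨ Σ<-cong L (λ p p<L → cong (weight ∘ Maybe.map typ) (nth-H₀ p p<L)) ⟩
      Σ< L (λ p → weight (Maybe.map typ (nth H₀ p)))
    ≡⟨ Σ<-nth (weight ∘ Maybe.map typ) H₀ ⟩
      Σl H₀ (λ τ → 2 ^ (T ∸ typ τ))
    ≡⟨ Σ-H₀ (λ i → 2 ^ (T ∸ i)) ⟩
      2 ^ k * Σl (types v T) (λ i → 2 ^ i * 2 ^ (T ∸ i))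
    ≡⟨ cong (2 ^ k *_) (Σ-congIn (types v T) (λ i i∈ → trans (sym (^-distribˡ-+-* 2 i (T ∸ i)))
                                                          (cong (2 ^_) (m+[n∸m]≡n (proj₂ (types-mem v T i∈)))))) ⟩
      2 ^ k * Σl (types v T) (λ _ → 2 ^ T)
    ≡⟨ cong (2 ^ k *_) (trans (Σ-const (types v T) (2 ^ T)) (cong (_* 2 ^ T) (length-types v T))) ⟩
      2 ^ k * (suc k * 2 ^ T)
    ∎
    where open ≡-Reasoning

module Summation (v : Variant) (k d m n : ℕ) (χ : Edge m n → Fin d) (E : List (Edge m n))
                 (proper : ProperColoring E χ) (d≤L : d ≤ Starts.L v k) where
  open Hstructure v k
  open Starts v k
  open EdgeAnalysis v k d m n χ E proper

  N : ℕ
  N = 2 ^ T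

  labelsA = allVecsOf (allBits T) m
  labelsB = allVecsOf (allBits T) n

  A₀ : ℕ
  A₀ = N ^ m * N ^ n * (p₀ * p₀)

  keptAt : ℕ → Edge m n → ℕ
  keptAt j e = Σl labelsA (λ la → Σl labelsB (λ lb → ind (Outcome.kept v T d m n χ j la lb E e)))

  keptTotal : Edge m n → ℕ
  keptTotal e = Σl (starts v T) (λ j → keptAt j e)

  -- For start j the edge of colour c sits at position j + c of H, so its type is typeAt (j + c).
  per-start : ∀ x y → (x , y) ∈ E → ∀ j → j < L →
    A₀ * weight (typeAt (j + toℕ (χ (x , y)))) ≤ keptAt j (x , y) * (q₀ * q₀) * (N * N)
  per-start x y e∈ j j<L with nth-defined H (j + c) (subst (j + c <_) (sym length-H) (+-mono-< j<L c<L))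
    where
    c = toℕ (χ (x , y))
    c<L : c < L
    c<L = ≤-trans (toℕ<n (χ (x , y))) d≤L
  ... | (a , i , z) , Fe =
    subst (λ w → A₀ * w ≤ keptAt j (x , y) * (q₀ * q₀) * (N * N)) (sym (cong weight (cong (Maybe.map typ) Fe)))
      (begin
        A₀ * 2 ^ (T ∸ i)
      ≤⟨ *-monoˡ-≤ (2 ^ (T ∸ i)) kept-bound ⟩
        keptCount * (q₀ * q₀) * (N * 2 ^ i) * 2 ^ (T ∸ i)
      ≡⟨ *-assoc (keptCount * (q₀ * q₀)) (N * 2 ^ i) (2 ^ (T ∸ i)) ⟩
        keptCount * (q₀ * q₀) * (N * 2 ^ i * 2 ^ (T ∸ i))
      ≡⟨ cong (λ w → keptCount * (q₀ * q₀) * w)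
              (trans (*-assoc N (2 ^ i) (2 ^ (T ∸ i)))
                     (cong (N *_) (trans (sym (^-distribˡ-+-* 2 i (T ∸ i))) (cong (2 ^_) (m+[n∸m]≡n (proj₂ i-bounds)))))) ⟩
        keptCount * (q₀ * q₀) * (N * N)
      ∎)
    where
    open ≤-Reasoning
    open Start.Event j x y a i z Fe e∈ using (kept-bound; keptCount; i-bounds)

  -- Per edge, summing over the L starts: Σ_j Pr_j[e ∈ E'] ≥ (p₀/q₀)² (k+1)/4.  The types seen
  -- by e run through a full period of H, so Σ_j 2^-i(j) = 2^k (k+1) and 2^k · 2^-t = 1/4.
  per-edge : ∀ x y → (x , y) ∈ E → A₀ * suc k ≤ keptTotal (x , y) * (q₀ * q₀) * 4
  per-edge x y e∈ = *-cancelʳ-≤ (A₀ * suc k) (keptTotal (x , y) * (q₀ * q₀) * 4) (N * 2 ^ k)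
    {{m*n≢0 N (2 ^ k) {{m^n≢0 2 T}} {{m^n≢0 2 k}}}}
    (begin
      A₀ * suc k * (N * 2 ^ k)
    ≡⟨ regroup₁ A₀ (suc k) N (2 ^ k) ⟩
      A₀ * (2 ^ k * (suc k * N))
    ≡⟨ cong (A₀ *_) (sym Σ-weights) ⟩
      A₀ * Σ< L (weight ∘ typeAt)
    ≡⟨ cong (A₀ *_) (sym (Σ<-shift L c (weight ∘ typeAt) (<⇒≤ c<L)
                                  (λ p p<c → cong weight (typeAt-periodic p (<-trans p<c c<L))))) ⟩
      A₀ * Σ< L (λ j → weight (typeAt (j + c)))
    ≡⟨ sym (Σ-scale (upTo L) A₀ _) ⟩
      Σ< L (λ j → A₀ * weight (typeAt (j + c)))
    ≤⟨ Σ<-mono L (per-start x y e∈) ⟩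
      Σ< L (λ j → keptAt j (x , y) * (q₀ * q₀) * (N * N))
    ≡⟨ sym (Σ-starts _) ⟩
      Σl (starts v T) (λ j → keptAt j (x , y) * (q₀ * q₀) * (N * N))
    ≡⟨ trans (Σ-scaleʳ (starts v T) (N * N) (λ j → keptAt j (x , y) * (q₀ * q₀)))
             (cong (_* (N * N)) (Σ-scaleʳ (starts v T) (q₀ * q₀) (λ j → keptAt j (x , y)))) ⟩
      keptTotal (x , y) * (q₀ * q₀) * (N * N)
    ≡⟨ cong (λ w → keptTotal (x , y) * (q₀ * q₀) * (N * w)) (^-distribˡ-+-* 2 2 k) ⟩
      keptTotal (x , y) * (q₀ * q₀) * (N * (4 * 2 ^ k))
    ≡⟨ regroup₂ (keptTotal (x , y)) (q₀ * q₀) N (2 ^ k) ⟩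
      keptTotal (x , y) * (q₀ * q₀) * 4 * (N * 2 ^ k)
    ∎)
    where
    open ≤-Reasoning
    c = toℕ (χ (x , y))
    c<L : c < L
    c<L = ≤-trans (toℕ<n (χ (x , y))) d≤L
    regroup₁ : ∀ a s ν t → a * s * (ν * t) ≡ a * (t * (s * ν))
    regroup₁ = solve-∀
    regroup₂ : ∀ g q ν t → g * q * (ν * (4 * t)) ≡ g * q * 4 * (ν * t)
    regroup₂ = solve-∀

  totalKept≡ : totalKept v T d m n χ E ≡ Σl E keptTotal
  totalKept≡ =
    trans (Σ-cong (starts v T) (λ j → Σ-cong labelsA (λ la →
             trans (Σ-cong labelsB (λ lb → length-filter (Outcome.kept v T d m n χ j la lb E) E))
                   (Σ-swap labelsB E (λ lb e → ind (Outcome.kept v T d m n χ j la lb E e))))))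
    (trans (Σ-cong (starts v T) (λ j →
             Σ-swap labelsA E (λ la e → Σl labelsB (λ lb → ind (Outcome.kept v T d m n χ j la lb E e)))))
           (Σ-swap (starts v T) E keptAt))

  numOutcomes≡ : numOutcomes v T m n ≡ L * N ^ m * N ^ n
  numOutcomes≡ = cong₂ _*_ (cong₂ _*_ length-starts (labelings m)) (labelings n)
    where
    labelings : ∀ r → length (allVecsOf (allBits T) r) ≡ N ^ r
    labelings r = trans (length-allVecsOf (allBits T) r) (cong (_^ r) (length-allBits T))

  -- Summing per-edge bounds: E[|E'|] ≥ (p₀/q₀)² (k+1)/(4L) |E| ≥ (k+1)/(240 d) |E| when L ≤ 8d,
  -- since 4 · 8 · q₀² ≤ 240 · p₀².
  expected-size : L ≤ 8 * d → suc k * length E * numOutcomes v T m n ≤ 240 * d * totalKept v T d m n χ E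
  expected-size L≤8d = *-cancelʳ-≤ _ _ (p₀ * p₀)
    (begin
      suc k * length E * numOutcomes v T m n * (p₀ * p₀)
    ≡⟨ cong (λ w → suc k * length E * w * (p₀ * p₀)) numOutcomes≡ ⟩
      suc k * length E * (L * N ^ m * N ^ n) * (p₀ * p₀)
    ≡⟨ regroup₁ (suc k) (length E) L (N ^ m) (N ^ n) (p₀ * p₀) ⟩
      L * (length E * (A₀ * suc k))
    ≤⟨ *-monoʳ-≤ L sum-edges ⟩
      L * (S * (q₀ * q₀ * 4))
    ≤⟨ *-monoˡ-≤ (S * (q₀ * q₀ * 4)) L≤8d ⟩
      8 * d * (S * (q₀ * q₀ * 4))
    ≡⟨ regroup₂ d S (q₀ * q₀) ⟩
      d * S * (32 * (q₀ * q₀))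
    ≤⟨ *-monoʳ-≤ (d * S) numeric ⟩
      d * S * (240 * (p₀ * p₀))
    ≡⟨ regroup₃ d S (p₀ * p₀) ⟩
      240 * d * S * (p₀ * p₀)
    ≡⟨ cong (λ w → 240 * d * w * (p₀ * p₀)) (sym totalKept≡) ⟩
      240 * d * totalKept v T d m n χ E * (p₀ * p₀)
    ∎)
    where
    open ≤-Reasoning
    S = Σl E keptTotal
    sum-edges : length E * (A₀ * suc k) ≤ S * (q₀ * q₀ * 4)
    sum-edges = subst₂ _≤_ (Σ-const E (A₀ * suc k)) (Σ-scaleʳ E (q₀ * q₀ * 4) keptTotal)
      (Σ-mono E (λ { (x , y) e∈ → subst (A₀ * suc k ≤_) (*-assoc (keptTotal (x , y)) (q₀ * q₀) 4) (per-edge x y e∈) }))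
    numeric : 32 * (q₀ * q₀) ≤ 240 * (p₀ * p₀)
    numeric = ≤ᵇ⇒≤ (32 * (q₀ * q₀)) (240 * (p₀ * p₀)) tt
    regroup₁ : ∀ s e l a b p → s * e * (l * a * b) * p ≡ l * (e * (a * b * p * s))
    regroup₁ = solve-∀
    regroup₂ : ∀ d s q → 8 * d * (s * (q * 4)) ≡ d * s * (32 * q)
    regroup₂ = solve-∀
    regroup₃ : ∀ d s p → d * s * (240 * p) ≡ 240 * d * s * p
    regroup₃ = solve-∀

⌈/2⌉-upper : ∀ K → K ≤ 2 * ⌈ K /2⌉
⌈/2⌉-upper zero = z≤n
⌈/2⌉-upper (suc zero) = s≤s z≤n
⌈/2⌉-upper (suc (suc K)) =
  subst (suc (suc K) ≤_) (sym (cong suc (+-suc ⌈ K /2⌉ (⌈ K /2⌉ + 0)))) (s≤s (s≤s (⌈/2⌉-upper K)))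

⌈/2⌉-lower : ∀ K → 2 * ⌈ K /2⌉ ≤ suc K
⌈/2⌉-lower zero = z≤n
⌈/2⌉-lower (suc zero) = s≤s (s≤s z≤n)
⌈/2⌉-lower (suc (suc K)) =
  subst (_≤ suc (suc (suc K))) (sym (cong suc (+-suc ⌈ K /2⌉ (⌈ K /2⌉ + 0)))) (s≤s (s≤s (⌈/2⌉-lower K)))

-- n ≤ 2^⌈log n⌉, by the same recursion on ⌈n/2⌉ that defines ⌈log₂⌉.
≤2^⌈log2⌉ : ∀ n (acc : Acc _<_ n) → n ≤ 2 ^ ⌈log2⌉ n acc
≤2^⌈log2⌉ zero _ = z≤n
≤2^⌈log2⌉ (suc zero) _ = s≤s z≤n
≤2^⌈log2⌉ (suc (suc n)) (acc rs) =
  ≤-trans (s≤s (s≤s (⌈/2⌉-upper n)))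
          (≤-trans (≤-reflexive (sym double)) (*-monoʳ-≤ 2 (≤2^⌈log2⌉ (suc ⌈ n /2⌉) _)))
  where
  double : 2 * suc ⌈ n /2⌉ ≡ suc (suc (2 * ⌈ n /2⌉))
  double = cong suc (+-suc ⌈ n /2⌉ (⌈ n /2⌉ + 0))

module Parameter (d : ℕ) (2≤d : 2 ≤ d) where
  K = ⌈log₂ d ⌉
  h = ⌈ K /2⌉
  k = h ∸ 1

  1≤K : 1 ≤ K
  1≤K = ⌈log₂⌉-mono-≤ 2≤d

  1≤h : 1 ≤ h
  1≤h with h | ⌈/2⌉-upper K
  ... | zero | K≤0 = ⊥-elim (<⇒≱ 1≤K K≤0)
  ... | suc _ | _ = s≤s z≤n

  suc-k : suc k ≡ h
  suc-k = trans (+-comm 1 k) (m∸n+n≡m 1≤h)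

  t≡ : tParam d ≡ 2 + k
  t≡ = trans (+-comm h 1) (cong suc (sym suc-k))

  d-upper : d ≤ 2 ^ (2 * suc k)
  d-upper = ≤-trans (≤2^⌈log2⌉ d (<-wellFounded d))
                    (^-monoʳ-≤ 2 (subst (λ w → K ≤ 2 * w) (sym suc-k) (⌈/2⌉-upper K)))

  -- 2^(K-1) < d, as otherwise ⌈log d⌉ ≤ K - 1.
  d-above : 2 ^ (K ∸ 1) < d
  d-above with d ≤? 2 ^ (K ∸ 1)
  ... | no d≰ = ≰⇒> d≰
  ... | yes d≤ = ⊥-elim (<⇒≱ (K∸1<K K 1≤K)
                              (≤-trans (⌈log₂⌉-mono-≤ d≤) (≤-reflexive (⌈log₂2^n⌉≡n (K ∸ 1)))))
    where
    K∸1<K : ∀ K → 1 ≤ K → K ∸ 1 < K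
    K∸1<K (suc K) _ = ≤-refl

  d-lower : 2 ^ (2 * k) ≤ d
  d-lower = ≤-trans (^-monoʳ-≤ 2 2k≤K∸1) (<⇒≤ d-above)
    where
    2k+2≤K+1 : 2 * suc k ≤ suc K
    2k+2≤K+1 = subst (λ w → 2 * w ≤ suc K) (sym suc-k) (⌈/2⌉-lower K)
    2k≤K∸1 : 2 * k ≤ K ∸ 1
    2k≤K∸1 = <⇒≤∸1 (≤-pred (subst (_≤ suc K) (cong suc (+-suc k (k + 0))) 2k+2≤K+1))

-- Lemma 6.  With t = k + 2, the first inequality is expected-size, whose hypotheses come from
-- 4^(k+1) ≤ L ≤ 8 · 4^k and 4^k ≤ d ≤ 4^(k+1); the second is d ≤ 4^(k+1).  (The bound does not
-- need E to be duplicate-free.)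
lemma6 : (v : Variant) (d : ℕ) → 2 ≤ d → (m n : ℕ) (E : List (Edge m n)) → Unique E →
         (χ : Edge m n → Fin d) → ProperColoring E χ →
         ((tParam d ∸ 1) * length E * numOutcomes v (tParam d) m n
            ≤ 240 * d * totalKept v (tParam d) d m n χ E)
         × (d ≤ 2 ^ (2 * (tParam d ∸ 1)))
lemma6 v d 2≤d m n E _ χ proper =
  subst (λ t → (t ∸ 1) * length E * numOutcomes v t m n ≤ 240 * d * totalKept v t d m n χ E) (sym t≡) expectation
  , subst (λ t → d ≤ 2 ^ (2 * (t ∸ 1))) (sym t≡) d-upper
  where
  open Parameter d 2≤d
  open Starts v k using (L-lower; L-upper)
  expectation : suc k * length E * numOutcomes v (2 + k) m n ≤ 240 * d * totalKept v (2 + k) d m n χ E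
  expectation = Summation.expected-size v k d m n χ E proper (≤-trans d-upper L-lower)
                                        (≤-trans L-upper (*-monoʳ-≤ 8 d-lower))
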